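{- Let $\mathbb{K}$ be a field of characteristic $0$, $\rho:\mathbb{N}^+\to\mathbb{K}$ any function, and $f(x)\in\mathbb{K}[[x]]$ with $$1+\sum_{n\ge1}\Big(\sum_{F\in F(n)}\prod_{h\in\mathcal{H}(F)}\rho(h)\Big)\frac{x^n}{n!}=f(x).$$ Then for every $n\ge1$ with $[x^{n-1}]f(x)\neq0$, $$\rho(n)=\frac{[x^n]\ln f(x)}{[x^{n-1}]f(x)}.$$
   Context: $F(n)$ is the set of labeled forests on the vertex set $\{1,\dots,n\}$, i.e. sets of rooted labeled trees (children unordered) whose vertex sets partition $\{1,\dots,n\}$. For a vertex $u$ of $F$, the hook length $h_u$ is the number of descendants of $u$ (counting $u$ itself), and $\mathcal{H}(F)$ is the multiset of hook lengths of all vertices; the product is over all vertices. Since $f(0)=1$, $\ln f(x)$ is the formal logarithm $\sum_{m\ge1}(-1)^{m-1}(f(x)-1)^m/m$. $[x^n]g(x)$ is the (ordinary) coefficient of $x^n$. -}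

module Defs where

open import Level using (Level; _⊔_) renaming (suc to lsuc)
open import Algebra.Bundles using (CommutativeRing)
open import Data.Nat using (ℕ; zero; suc; pred; _∸_; NonZero)
open import Data.Bool using (Bool; true; false)
open import Data.Fin using (Fin; _≟_)
open import Data.Maybe using (Maybe; just; nothing; is-nothing; _>>=_)
open import Data.List using (List; []; _∷_; [_]; map; concatMap; filterᵇ; length; foldr; upTo; allFin)
open import Data.Bool.ListAction using (all; any)
open import Data.Vec.Functional using () renaming (_∷_ to _∷ᶠ_)
open import Data.Product using (Σ; proj₁)
open import Relation.Nullary using (¬_; does)

record Field (c ℓ : Level) : Set (lsuc (c ⊔ ℓ)) where
  field
    commutativeRing : CommutativeRing c ℓ
  open CommutativeRing commutativeRing public
  field
    0≉1     : ¬ (0# ≈ 1#)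
    inverse : (x : Carrier) → ¬ (x ≈ 0#) → Σ Carrier (λ y → (x * y) ≈ 1#)

-- A rooted labeled forest (children unordered) is encoded by its parent
-- function: parent v = nothing iff v is a root.  A parent function is a
-- forest iff it is acyclic, i.e. following parents n times from any vertex
-- leaves the vertex set (every vertex reaches a root).

Parent : ℕ → Set
Parent n = Fin n → Maybe (Fin n)

anc : ∀ {n} → Parent n → ℕ → Fin n → Maybe (Fin n)
anc p zero    v = just v
anc p (suc k) v = anc p k v >>= p

isForest : ∀ {n} → Parent n → Bool
isForest {n} p = all (λ v → is-nothing (anc p n v)) (allFin n)

functions : ∀ {a} {A : Set a} (k : ℕ) → List A → List (Fin k → A)
functions zero    as = [ (λ ()) ]
functions (suc k) as = concatMap (λ a → map (a ∷ᶠ_) (functions k as)) as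

forests : (n : ℕ) → List (Parent n)
forests n = filterᵇ isForest (functions n (nothing ∷ map just (allFin n)))

isJust≡ : ∀ {n} → Maybe (Fin n) → Fin n → Bool
isJust≡ nothing  v = false
isJust≡ (just w) v = does (w ≟ v)

properDesc : ∀ {n} → Parent n → Fin n → Fin n → Bool
properDesc {n} p v u = any (λ k → isJust≡ (anc p (suc k) u) v) (upTo n)

hook : ∀ {n} → Parent n → Fin n → ℕ
hook {n} p v = suc (length (filterᵇ (properDesc p v) (allFin n)))

module _ {c ℓ : Level} (K : Field c ℓ) where
  open Field K hiding (zero)

  fromℕ : ℕ → Carrier
  fromℕ zero    = 0#
  fromℕ (suc m) = 1# + fromℕ m

  CharZero : Set ℓ
  CharZero = (m : ℕ) → ¬ (fromℕ (suc m) ≈ 0#)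

  inv : (x : Carrier) → ¬ (x ≈ 0#) → Carrier
  inv x nz = proj₁ (inverse x nz)

  forestSum : ((m : ℕ) → .{{NonZero m}} → Carrier) → (n : ℕ) → Carrier
  forestSum ρ n = foldr (λ p acc → weight p + acc) 0# (forests n)
    where
    weight : Parent n → Carrier
    weight p = foldr (λ v acc → ρ (hook p v) * acc) 1# (allFin n)

  Series : Set c
  Series = ℕ → Carrier

  sumBelow : (ℕ → Carrier) → ℕ → Carrier
  sumBelow g zero    = 0#
  sumBelow g (suc n) = sumBelow g n + g n

  mulS : Series → Series → Series
  mulS g h n = sumBelow (λ i → g i * h (n ∸ i)) (suc n)

  oneS : Series
  oneS zero    = 1#
  oneS (suc n) = 0#

  powS : Series → ℕ → Series
  powS g zero    = oneS
  powS g (suc m) = mulS g (powS g m)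

  minusOne : Series → Series
  minusOne f zero    = f zero - 1#
  minusOne f (suc n) = f (suc n)

  signPow : ℕ → Carrier
  signPow zero    = 1#
  signPow (suc m) = - signPow m

  module _ (ch : CharZero) where

    recipSuc : ℕ → Carrier
    recipSuc m = inv (fromℕ (suc m)) (ch m)

    recip : (m : ℕ) → .{{NonZero m}} → Carrier
    recip (suc m) = recipSuc m

    -- [x^n] ln f(x) = [x^n] Σ_{m ≥ 1} (-1)^{m-1} (f(x) - 1)^m / m ;
    -- when f(0) = 1 only the terms m ≤ n contribute to x^n.
    lnCoeff : Series → ℕ → Carrier
    lnCoeff f n =
      sumBelow (λ m → (signPow m * recipSuc m) * powS (minusOne f) (suc m) n) n

-- Cutting off the tree of a fixed vertex (C(n, j) choices of its other j vertices, j + 1 choices of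
-- its root, whose deletion leaves a forest on j vertices) gives the recurrence
--   F(n+1) = Σⱼ C(n,j) (j+1) ρ(j+1) F(j) F(n-j)
-- for the forest sums F. For f = Σ F(n) xⁿ/n! it says f' = t' f with t = Σₙ ρ(n+1) fₙ xⁿ⁺¹, and since
-- t(0) = 0 this forces t = ln f.
module Submission where

open import Defs
open import Data.Nat as N using (ℕ; zero; suc; NonZero; _!; _∸_; z≤n; s≤s)
open import Data.Nat.Properties using (_!≢0; m*n≢0)
import Data.Nat.Properties as NP
open import Data.Nat.Combinatorics using (k![n∸k]!∣n!; nCk+nC[k+1]≡[n+1]C[k+1]) renaming (_C_ to _𝐂_)
open import Data.Nat.Combinatorics.Specification using (nCk≡n!/k![n-k]!; k>n⇒nCk≡0)
open import Data.Nat.DivMod using (m/n*n≡m)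
open import Data.Nat.Induction using (<-rec)
open import Data.Fin as F using (Fin; toℕ; zero; suc)
import Data.Fin.Properties as FP
open import Data.Bool using (Bool; true; false; _∧_; _∨_; not; if_then_else_)
import Data.Bool.Properties as BP
open import Data.Maybe using (Maybe; just; nothing; is-nothing; _>>=_; maybe; fromMaybe)
open import Data.Maybe.Properties using (just-injective)
open import Data.List using (List; []; _∷_; map; concatMap; filterᵇ; length; foldr; allFin; tabulate; _++_; applyUpTo)
open import Data.List.Properties using (length-tabulate)
open import Data.Bool.ListAction using (all; any)
open import Data.Vec.Functional using () renaming (_∷_ to _∷ᶠ_)
open import Data.Product using (Σ; ∃₂; _,_; proj₁; proj₂; _×_)
open import Data.Sum using (inj₁; inj₂)
open import Data.Empty using (⊥; ⊥-elim)
open import Relation.Nullary using (¬_; Dec; does; yes; no)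
open import Relation.Binary.PropositionalEquality as P using (_≡_)
open import Tactic.RingSolver.Core.AlmostCommutativeRing using (fromCommutativeRing)

∧-elim : ∀ {a b} → (a ∧ b) ≡ true → (a ≡ true) × (b ≡ true)
∧-elim {true} {true} _ = P.refl , P.refl

∧-intro : ∀ {a b} → a ≡ true → b ≡ true → (a ∧ b) ≡ true
∧-intro P.refl P.refl = P.refl

not≡true⇒≡false : ∀ {b} → not b ≡ true → b ≡ false
not≡true⇒≡false {false} _ = P.refl

≡false⇒not≡true : ∀ {b} → b ≡ false → not b ≡ true
≡false⇒not≡true P.refl = P.refl

true≢false : ∀ {b : Bool} → b ≡ true → b ≡ false → ∀ {a} {X : Set a} → X
true≢false P.refl ()

bool-ext : ∀ {x y : Bool} → (x ≡ true → y ≡ true) → (y ≡ true → x ≡ true) → x ≡ y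
bool-ext {true}  {true}  _ _ = P.refl
bool-ext {true}  {false} f _ = P.sym (f P.refl)
bool-ext {false} {true}  _ g = g P.refl
bool-ext {false} {false} _ _ = P.refl

all-tabulate : ∀ {A : Set} {k} (f : A → Bool) (g : Fin k → A) →
               all f (tabulate g) ≡ all (λ i → f (g i)) (allFin k)
all-tabulate {k = zero}  f g = P.refl
all-tabulate {k = suc k} f g = P.cong (f (g zero) ∧_)
  (P.trans (all-tabulate f (λ i → g (suc i))) (P.sym (all-tabulate (λ i → f (g i)) suc)))

all⇒ : ∀ {k} (f : Fin k → Bool) → all f (allFin k) ≡ true → ∀ v → f v ≡ true
all⇒ {suc k} f e zero    = proj₁ (∧-elim e)
all⇒ {suc k} f e (suc v) = all⇒ (λ i → f (suc i)) (P.trans (P.sym (all-tabulate f suc)) (proj₂ (∧-elim e))) v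

⇒all : ∀ {k} (f : Fin k → Bool) → (∀ v → f v ≡ true) → all f (allFin k) ≡ true
⇒all {zero}  f e = P.refl
⇒all {suc k} f e rewrite e zero | all-tabulate f suc = ⇒all (λ i → f (suc i)) (λ v → e (suc v))

any-applyUpTo⁻ : ∀ (f : ℕ → Bool) (g : ℕ → ℕ) n → any f (applyUpTo g n) ≡ true →
                 Σ ℕ λ k → k N.< n × f (g k) ≡ true
any-applyUpTo⁻ f g (suc n) e with f (g 0) in eq
... | true  = 0 , s≤s z≤n , eq
... | false with any-applyUpTo⁻ f (λ i → g (suc i)) n e
... | k , k<n , fk = suc k , s≤s k<n , fk

any-applyUpTo⁺ : ∀ (f : ℕ → Bool) (g : ℕ → ℕ) n k → k N.< n → f (g k) ≡ true → any f (applyUpTo g n) ≡ true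
any-applyUpTo⁺ f g (suc n) zero    _   e rewrite e = P.refl
any-applyUpTo⁺ f g (suc n) (suc k) k<n e with f (g 0)
... | true  = P.refl
... | false = any-applyUpTo⁺ f (λ i → g (suc i)) n k (N.s≤s⁻¹ k<n) e

filterᵇ-cong : ∀ {A : Set} {f g : A → Bool} (xs : List A) → (∀ x → f x ≡ g x) → filterᵇ f xs ≡ filterᵇ g xs
filterᵇ-cong [] e = P.refl
filterᵇ-cong {f = f} {g} (x ∷ xs) e with f x | g x | e x
... | true  | true  | _ = P.cong (x ∷_) (filterᵇ-cong xs e)
... | false | false | _ = filterᵇ-cong xs e

foldr-tabulate : ∀ {a b} {A : Set a} {B : Set b} {k} (_⊕_ : A → B → B) (e : B) (g : Fin k → A) →
                 foldr _⊕_ e (tabulate g) ≡ foldr (λ i → g i ⊕_) e (allFin k)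
foldr-tabulate {k = zero}  _⊕_ e g = P.refl
foldr-tabulate {k = suc k} _⊕_ e g = P.cong (g zero ⊕_)
  (P.trans (foldr-tabulate _⊕_ e (λ i → g (suc i))) (P.sym (foldr-tabulate (λ i → g i ⊕_) e suc)))

length-filter-tabulate : ∀ {A : Set} {k} (f : A → Bool) (g : Fin k → A) →
                         length (filterᵇ f (tabulate g)) ≡ length (filterᵇ (λ i → f (g i)) (allFin k))
length-filter-tabulate {k = zero}  f g = P.refl
length-filter-tabulate {k = suc k} f g with f (g zero)
... | true  = P.cong suc (P.trans (length-filter-tabulate f (λ i → g (suc i)))
                                  (P.sym (length-filter-tabulate (λ i → f (g i)) suc)))
... | false = P.trans (length-filter-tabulate f (λ i → g (suc i))) (P.sym (length-filter-tabulate (λ i → f (g i)) suc))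

length-filter-split : ∀ {A : Set} (f g : A → Bool) (xs : List A) →
  length (filterᵇ f xs) ≡ length (filterᵇ (λ v → f v ∧ g v) xs) N.+ length (filterᵇ (λ v → f v ∧ not (g v)) xs)
length-filter-split f g [] = P.refl
length-filter-split f g (x ∷ xs) with f x | g x
... | true  | true  = P.cong suc (length-filter-split f g xs)
... | true  | false = P.trans (P.cong suc (length-filter-split f g xs)) (P.sym (NP.+-suc _ _))
... | false | _     = length-filter-split f g xs

_==F_ : ∀ {N} → Fin N → Fin N → Bool
a ==F b = does (a F.≟ b)

==F-refl : ∀ {N} (a : Fin N) → (a ==F a) ≡ true
==F-refl a with a F.≟ a
... | yes _ = P.refl
... | no a≢a = ⊥-elim (a≢a P.refl)

==F⇒≡ : ∀ {N} {a b : Fin N} → (a ==F b) ≡ true → a ≡ b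
==F⇒≡ {a = a} {b} e with a F.≟ b
... | yes a≡b = a≡b

≢⇒==F-false : ∀ {N} {a b : Fin N} → ¬ (a ≡ b) → (a ==F b) ≡ false
≢⇒==F-false {a = a} {b} a≢b with a F.≟ b
... | yes a≡b = ⊥-elim (a≢b a≡b)
... | no _    = P.refl

length-filter-false : ∀ {A : Set} (xs : List A) → length (filterᵇ (λ _ → false) xs) ≡ 0
length-filter-false []       = P.refl
length-filter-false (_ ∷ xs) = length-filter-false xs

length-filter-==F : ∀ {k} (r : Fin k) → length (filterᵇ (_==F r) (allFin k)) ≡ 1
length-filter-==F {suc k} zero rewrite ==F-refl {suc k} zero =
  P.cong suc (P.trans (length-filter-tabulate (λ v → _==F_ {suc k} v zero) suc)
                      (P.trans (P.cong length (filterᵇ-cong (allFin k) (λ v → ≢⇒==F-false {suc k} {suc v} {zero} λ ())))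
                               (length-filter-false (allFin k))))
length-filter-==F {suc k} (suc r) rewrite ≢⇒==F-false {suc k} {zero} {suc r} (λ ()) =
  P.trans (length-filter-tabulate (λ v → _==F_ {suc k} v (suc r)) suc) (length-filter-==F r)

eqMaybe : ∀ {N} → Maybe (Fin N) → Maybe (Fin N) → Bool
eqMaybe nothing  nothing  = true
eqMaybe (just a) (just b) = a ==F b
eqMaybe _        _        = false

eqMaybe⇒≡ : ∀ {N} {a b : Maybe (Fin N)} → eqMaybe a b ≡ true → a ≡ b
eqMaybe⇒≡ {a = nothing} {nothing} _ = P.refl
eqMaybe⇒≡ {a = just a}  {just b}  e = P.cong just (==F⇒≡ e)

eqMaybe-refl : ∀ {N} (a : Maybe (Fin N)) → eqMaybe a a ≡ true
eqMaybe-refl nothing  = P.refl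
eqMaybe-refl (just a) = ==F-refl a

eqBool : Bool → Bool → Bool
eqBool true  true  = true
eqBool false false = true
eqBool _     _     = false

eqBool⇒≡ : ∀ {a b} → eqBool a b ≡ true → a ≡ b
eqBool⇒≡ {true}  {true}  _ = P.refl
eqBool⇒≡ {false} {false} _ = P.refl

eqBool-refl : ∀ a → eqBool a a ≡ true
eqBool-refl true  = P.refl
eqBool-refl false = P.refl

pointwiseᵇ : ∀ {A : Set} → (A → A → Bool) → ∀ k → (Fin k → A) → (Fin k → A) → Bool
pointwiseᵇ eq k p q = all (λ v → eq (p v) (q v)) (allFin k)

pointwiseᵇ⇒ : ∀ {A : Set} {eq : A → A → Bool} {k} {p q : Fin k → A} →
              pointwiseᵇ eq k p q ≡ true → ∀ v → eq (p v) (q v) ≡ true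
pointwiseᵇ⇒ {eq = eq} {p = p} {q} = all⇒ (λ v → eq (p v) (q v))

⇒pointwiseᵇ : ∀ {A : Set} {eq : A → A → Bool} → (∀ a → eq a a ≡ true) → ∀ {k} {p q : Fin k → A} →
              (∀ v → p v ≡ q v) → pointwiseᵇ eq k p q ≡ true
⇒pointwiseᵇ {eq = eq} eq-refl {p = p} {q} p≗q =
  ⇒all (λ v → eq (p v) (q v)) (λ v → P.subst (λ z → eq (p v) z ≡ true) (p≗q v) (eq-refl (p v)))

module PowerSeries {c ℓ} (K : Field c ℓ) where
  open Field K hiding (zero)
  open import Relation.Binary.Reasoning.Setoid setoid
  open import Algebra.Properties.Ring ring using (-‿distribˡ-*; -‿involutive; -0#≈0#; +-cancelˡ)
  open import Algebra.Properties.CommutativeSemigroup +-commutativeSemigroup using (interchange)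
  open import Algebra.Properties.CommutativeSemigroup *-commutativeSemigroup using (x∙yz≈y∙xz; x∙yz≈yx∙z)
  open import Tactic.RingSolver.NonReflective (fromCommutativeRing commutativeRing (λ _ → nothing))
    using (solve; _⊜_; _⊕_; _⊗_)

  ι : ℕ → Carrier
  ι = fromℕ K

  Σ< : (ℕ → Carrier) → ℕ → Carrier
  Σ< = sumBelow K

  _⋆_ : Series K → Series K → Series K
  _⋆_ = mulS K

  ∂ : Series K → Series K
  ∂ a n = ι (suc n) * a (suc n)

  ι-+ : ∀ m n → ι (m N.+ n) ≈ ι m + ι n
  ι-+ zero    n = sym (+-identityˡ _)
  ι-+ (suc m) n = trans (+-cong refl (ι-+ m n)) (sym (+-assoc _ _ _))

  ι-* : ∀ m n → ι (m N.* n) ≈ ι m * ι n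
  ι-* zero    n = sym (zeroˡ _)
  ι-* (suc m) n = begin
    ι (n N.+ m N.* n)    ≈⟨ ι-+ n (m N.* n) ⟩
    ι n + ι (m N.* n)    ≈⟨ +-cong (sym (*-identityˡ _)) (ι-* m n) ⟩
    1# * ι n + ι m * ι n ≈⟨ distribʳ _ _ _ ⟨
    ι (suc m) * ι n      ∎

  ι-∸ : ∀ {i n} → i N.≤ n → ι n ≈ ι i + ι (n ∸ i)
  ι-∸ {i} {n} i≤n = trans (reflexive (P.cong ι (P.sym (NP.m+[n∸m]≡n i≤n)))) (ι-+ i (n ∸ i))

  Σ<-cong< : ∀ {h h'} n → (∀ i → i N.< n → h i ≈ h' i) → Σ< h n ≈ Σ< h' n
  Σ<-cong< zero    e = refl
  Σ<-cong< (suc n) e = +-cong (Σ<-cong< n (λ i i<n → e i (NP.m<n⇒m<1+n i<n))) (e n NP.≤-refl)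

  Σ<-cong : ∀ {h h'} n → (∀ i → h i ≈ h' i) → Σ< h n ≈ Σ< h' n
  Σ<-cong n e = Σ<-cong< n (λ i _ → e i)

  Σ<-zero : ∀ h n → (∀ i → i N.< n → h i ≈ 0#) → Σ< h n ≈ 0#
  Σ<-zero h zero    e = refl
  Σ<-zero h (suc n) e =
    trans (+-cong (Σ<-zero h n (λ i i<n → e i (NP.m<n⇒m<1+n i<n))) (e n NP.≤-refl)) (+-identityʳ 0#)

  Σ<-+ : ∀ h h' n → Σ< (λ i → h i + h' i) n ≈ Σ< h n + Σ< h' n
  Σ<-+ h h' zero    = sym (+-identityˡ 0#)
  Σ<-+ h h' (suc n) = trans (+-cong (Σ<-+ h h' n) refl) (interchange _ _ _ _)

  Σ<-*ˡ : ∀ a h n → Σ< (λ i → a * h i) n ≈ a * Σ< h n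
  Σ<-*ˡ a h zero    = sym (zeroʳ a)
  Σ<-*ˡ a h (suc n) = trans (+-cong (Σ<-*ˡ a h n) refl) (sym (distribˡ a _ _))

  Σ<-*ʳ : ∀ a h n → Σ< (λ i → h i * a) n ≈ Σ< h n * a
  Σ<-*ʳ a h n = trans (Σ<-cong n (λ i → *-comm (h i) a)) (trans (Σ<-*ˡ a h n) (*-comm a _))

  Σ<-head : ∀ h n → Σ< h (suc n) ≈ h 0 + Σ< (λ i → h (suc i)) n
  Σ<-head h zero    = +-comm 0# (h 0)
  Σ<-head h (suc n) = trans (+-cong (Σ<-head h n) refl) (+-assoc _ _ _)

  Σ<-reverse : ∀ h n → Σ< h n ≈ Σ< (λ i → h (n ∸ suc i)) n
  Σ<-reverse h zero    = refl
  Σ<-reverse h (suc n) = trans (+-cong (Σ<-reverse h n) refl)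
    (trans (+-comm _ _) (sym (Σ<-head (λ i → h (n ∸ i)) n)))

  Σ<-swap : ∀ (h : ℕ → ℕ → Carrier) n m → Σ< (λ i → Σ< (h i) m) n ≈ Σ< (λ j → Σ< (λ i → h i j) n) m
  Σ<-swap h zero    m = sym (Σ<-zero (λ _ → 0#) m (λ _ _ → refl))
  Σ<-swap h (suc n) m = trans (+-cong (Σ<-swap h n m) refl) (sym (Σ<-+ _ _ m))

  Σ<-extend : ∀ h {n m} → n N.≤ m → (∀ i → n N.≤ i → i N.< m → h i ≈ 0#) → Σ< h m ≈ Σ< h n
  Σ<-extend h {m = zero}  z≤n e = refl
  Σ<-extend h {m = suc m} n≤m e with NP.m≤n⇒m<n∨m≡n n≤m
  ... | inj₂ P.refl = refl
  ... | inj₁ n<sm   = trans (+-cong (Σ<-extend h (N.s≤s⁻¹ n<sm) (λ i n≤i i<m → e i n≤i (NP.m<n⇒m<1+n i<m)))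
                                    (e m (N.s≤s⁻¹ n<sm) NP.≤-refl))
                            (+-identityʳ _)

  Σ<-triangle : ∀ (h : ℕ → ℕ → Carrier) n →
    Σ< (λ i → Σ< (λ j → h j i) (suc i)) n ≈ Σ< (λ j → Σ< (λ l → h j (j N.+ l)) (n ∸ j)) n
  Σ<-triangle h zero    = refl
  Σ<-triangle h (suc n) = begin
      Σ< (λ i → Σ< (λ j → h j i) (suc i)) n + Σ< (λ j → h j n) (suc n)
    ≈⟨ +-cong (Σ<-triangle h n) refl ⟩
      Σ< row n + Σ< (λ j → h j n) (suc n)
    ≈⟨ +-cong (sym (trans (+-cong refl row-n) (+-identityʳ _))) refl ⟩
      Σ< row (suc n) + Σ< (λ j → h j n) (suc n)
    ≈⟨ Σ<-+ row (λ j → h j n) (suc n) ⟨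
      Σ< (λ j → row j + h j n) (suc n)
    ≈⟨ Σ<-cong< (suc n) extend-row ⟩
      Σ< (λ j → Σ< (λ l → h j (j N.+ l)) (suc n ∸ j)) (suc n) ∎
    where
    row : ℕ → Carrier
    row j = Σ< (λ l → h j (j N.+ l)) (n ∸ j)
    row-n : row n ≈ 0#
    row-n = reflexive (P.cong (Σ< (λ l → h n (n N.+ l))) (NP.n∸n≡0 n))
    extend-row : ∀ j → j N.< suc n → row j + h j n ≈ Σ< (λ l → h j (j N.+ l)) (suc n ∸ j)
    extend-row j j<sn = sym (trans (reflexive (P.cong (Σ< (λ l → h j (j N.+ l))) (NP.+-∸-assoc 1 j≤n)))
                                   (+-cong refl (reflexive (P.cong (h j) (NP.m+[n∸m]≡n j≤n)))))
      where j≤n = N.s≤s⁻¹ j<sn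

  ⋆-cong≤ : ∀ {a a' b b'} n → (∀ i → i N.≤ n → a i ≈ a' i) → (∀ i → i N.≤ n → b i ≈ b' i) →
            (a ⋆ b) n ≈ (a' ⋆ b') n
  ⋆-cong≤ n ea eb = Σ<-cong< (suc n) (λ i i<sn → *-cong (ea i (N.s≤s⁻¹ i<sn)) (eb (n ∸ i) (NP.m∸n≤m n i)))

  ⋆-cong : ∀ {a a' b b'} → (∀ i → a i ≈ a' i) → (∀ i → b i ≈ b' i) → ∀ n → (a ⋆ b) n ≈ (a' ⋆ b') n
  ⋆-cong ea eb n = ⋆-cong≤ n (λ i _ → ea i) (λ i _ → eb i)

  ⋆-comm : ∀ a b n → (a ⋆ b) n ≈ (b ⋆ a) n
  ⋆-comm a b n = trans (Σ<-reverse _ (suc n)) (Σ<-cong< (suc n) λ i i<sn →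
    trans (*-comm _ _) (*-cong (reflexive (P.cong b (NP.m∸[m∸n]≡n (N.s≤s⁻¹ i<sn)))) refl))

  ⋆-assoc : ∀ a b c n → ((a ⋆ b) ⋆ c) n ≈ (a ⋆ (b ⋆ c)) n
  ⋆-assoc a b c n = begin
      Σ< (λ i → Σ< (λ j → a j * b (i ∸ j)) (suc i) * c (n ∸ i)) (suc n)
    ≈⟨ Σ<-cong (suc n) (λ i → sym (Σ<-*ʳ (c (n ∸ i)) _ (suc i))) ⟩
      Σ< (λ i → Σ< (λ j → h j i) (suc i)) (suc n)
    ≈⟨ Σ<-triangle h (suc n) ⟩
      Σ< (λ j → Σ< (λ l → h j (j N.+ l)) (suc n ∸ j)) (suc n)
    ≈⟨ Σ<-cong< (suc n) factor-a ⟩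
      Σ< (λ j → a j * Σ< (λ l → b l * c ((n ∸ j) ∸ l)) (suc (n ∸ j))) (suc n) ∎
    where
    h : ℕ → ℕ → Carrier
    h j i = (a j * b (i ∸ j)) * c (n ∸ i)
    factor-a : ∀ j → j N.< suc n →
               Σ< (λ l → h j (j N.+ l)) (suc n ∸ j) ≈ a j * Σ< (λ l → b l * c ((n ∸ j) ∸ l)) (suc (n ∸ j))
    factor-a j j<sn = trans (reflexive (P.cong (Σ< (λ l → h j (j N.+ l))) (NP.+-∸-assoc 1 (N.s≤s⁻¹ j<sn))))
      (trans (Σ<-cong (suc (n ∸ j)) (λ l → trans (*-assoc _ _ _) (*-cong refl
         (*-cong (reflexive (P.cong b (NP.m+n∸m≡n j l))) (reflexive (P.cong c (P.sym (NP.∸-+-assoc n j l))))))))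
        (Σ<-*ˡ (a j) _ (suc (n ∸ j))))

  ⋆-identityˡ : ∀ a n → (oneS K ⋆ a) n ≈ a n
  ⋆-identityˡ a n =
    trans (Σ<-head _ n) (trans (+-cong (*-identityˡ _) (Σ<-zero _ n (λ i _ → zeroˡ _))) (+-identityʳ _))

  ⋆-distribˡ-+ : ∀ a b b' n → (a ⋆ (λ i → b i + b' i)) n ≈ (a ⋆ b) n + (a ⋆ b') n
  ⋆-distribˡ-+ a b b' n = trans (Σ<-cong (suc n) (λ i → distribˡ _ _ _)) (Σ<-+ _ _ (suc n))

  ⋆-*ʳ : ∀ a k b n → (a ⋆ (λ i → k * b i)) n ≈ k * (a ⋆ b) n
  ⋆-*ʳ a k b n = trans (Σ<-cong (suc n) (λ i → x∙yz≈y∙xz (a i) k _))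
                       (Σ<-*ˡ k _ (suc n))

  ⋆-Σ<ˡ : ∀ (h : ℕ → Series K) M b n → ((λ i → Σ< (λ m → h m i) M) ⋆ b) n ≈ Σ< (λ m → (h m ⋆ b) n) M
  ⋆-Σ<ˡ h M b n = trans (Σ<-cong (suc n) (λ i → sym (Σ<-*ʳ _ _ M))) (Σ<-swap (λ i m → h m i * b (n ∸ i)) (suc n) M)

  ⋆-vanishes : ∀ a b k → (∀ i → i N.≤ k → a i ≈ 0#) → (a ⋆ b) k ≈ 0#
  ⋆-vanishes a b k e = Σ<-zero _ (suc k) (λ i i< → trans (*-cong (e i (N.s≤s⁻¹ i<)) refl) (zeroˡ _))

  powS-vanishes : ∀ g → g 0 ≈ 0# → ∀ m i → i N.< m → powS K g m i ≈ 0#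
  powS-vanishes g g0 (suc m) i i<m = Σ<-zero _ (suc i) (λ j j< → term j i (N.s≤s⁻¹ j<) (N.s≤s⁻¹ i<m))
    where
    term : ∀ j i → j N.≤ i → i N.≤ m → g j * powS K g m (i ∸ j) ≈ 0#
    term zero    i       _ _   = trans (*-cong g0 refl) (zeroˡ _)
    term (suc j) (suc i) _ i<m = trans (*-cong refl (powS-vanishes g g0 m (i ∸ j) (NP.≤-trans (s≤s (NP.m∸n≤m i j)) i<m)))
                                       (zeroʳ _)

  ∂-⋆ : ∀ a b n → ∂ (a ⋆ b) n ≈ (∂ a ⋆ b) n + (a ⋆ ∂ b) n
  ∂-⋆ a b n = begin
      ι (suc n) * Σ< (λ i → a i * b (suc n ∸ i)) (suc (suc n))
    ≈⟨ Σ<-*ˡ _ _ (suc (suc n)) ⟨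
      Σ< (λ i → ι (suc n) * (a i * b (suc n ∸ i))) (suc (suc n))
    ≈⟨ Σ<-cong< (suc (suc n)) (λ i i< → trans (*-cong (ι-∸ (N.s≤s⁻¹ i<)) refl)
          (solve 4 (λ x y u v → ((x ⊕ y) ⊗ (u ⊗ v)) ⊜ (x ⊗ (u ⊗ v) ⊕ u ⊗ (y ⊗ v))) refl _ _ _ _)) ⟩
      Σ< (λ i → ι i * (a i * b (suc n ∸ i)) + a i * (ι (suc n ∸ i) * b (suc n ∸ i))) (suc (suc n))
    ≈⟨ Σ<-+ _ _ (suc (suc n)) ⟩
      Σ< (λ i → ι i * (a i * b (suc n ∸ i))) (suc (suc n)) + Σ< (λ i → a i * (ι (suc n ∸ i) * b (suc n ∸ i))) (suc (suc n))
    ≈⟨ +-cong ∂a-part a∂-part ⟩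
      (∂ a ⋆ b) n + (a ⋆ ∂ b) n ∎
    where
    ∂a-part : Σ< (λ i → ι i * (a i * b (suc n ∸ i))) (suc (suc n)) ≈ (∂ a ⋆ b) n
    ∂a-part = trans (Σ<-head _ (suc n))
                    (trans (+-cong (zeroˡ _) (Σ<-cong (suc n) (λ i → sym (*-assoc _ _ _)))) (+-identityˡ _))
    a∂-part : Σ< (λ i → a i * (ι (suc n ∸ i) * b (suc n ∸ i))) (suc (suc n)) ≈ (a ⋆ ∂ b) n
    a∂-part = trans (+-cong refl (trans (*-cong refl (trans (*-cong (reflexive (P.cong ι (NP.n∸n≡0 n))) refl) (zeroˡ _)))
                                        (zeroʳ _)))
      (trans (+-identityʳ _) (Σ<-cong< (suc n) (λ i i< → *-cong refl
        (reflexive (P.cong (λ k → ι k * b k) (NP.+-∸-assoc 1 (N.s≤s⁻¹ i<)))))))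

  ∂-powS : ∀ g m n → ∂ (powS K g (suc m)) n ≈ ι (suc m) * (powS K g m ⋆ ∂ g) n
  ∂-powS g zero n = trans (∂-⋆ g (oneS K) n)
    (trans (+-cong (⋆-comm (∂ g) (oneS K) n) (Σ<-zero _ (suc n) (λ i _ → trans (*-cong refl (zeroʳ _)) (zeroʳ _))))
    (trans (+-identityʳ _) (sym (trans (*-cong (+-identityʳ 1#) refl) (*-identityˡ _)))))
  ∂-powS g (suc m) n = begin
      ∂ (g ⋆ gᵐ⁺¹) n
    ≈⟨ ∂-⋆ g gᵐ⁺¹ n ⟩
      (∂ g ⋆ gᵐ⁺¹) n + (g ⋆ ∂ gᵐ⁺¹) n
    ≈⟨ +-cong (⋆-comm (∂ g) gᵐ⁺¹ n) (trans (⋆-cong {a = g} (λ _ → refl) (∂-powS g m) n)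
         (trans (⋆-*ʳ g (ι (suc m)) (powS K g m ⋆ ∂ g) n) (*-cong refl (sym (⋆-assoc g (powS K g m) (∂ g) n))))) ⟩
      (gᵐ⁺¹ ⋆ ∂ g) n + ι (suc m) * (gᵐ⁺¹ ⋆ ∂ g) n
    ≈⟨ solve 2 (λ x y → (x ⊕ y ⊗ x) ⊜ ((x ⊕ x ⊗ y))) refl _ _ ⟩
      (gᵐ⁺¹ ⋆ ∂ g) n + (gᵐ⁺¹ ⋆ ∂ g) n * ι (suc m)
    ≈⟨ trans (distribʳ _ _ _) (+-cong (*-identityˡ _) (*-comm _ _)) ⟨
      ι (suc (suc m)) * (gᵐ⁺¹ ⋆ ∂ g) n ∎
    where gᵐ⁺¹ = powS K g (suc m)

  *-cancelˡ-nonzero : ∀ x {y z} → ¬ (x ≈ 0#) → x * y ≈ x * z → y ≈ z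
  *-cancelˡ-nonzero x {y} {z} x≉0 e = begin
    y                    ≈⟨ *-identityˡ y ⟨
    1# * y               ≈⟨ *-cong x⁻¹x≈1 refl ⟨
    (x⁻¹ * x) * y        ≈⟨ *-assoc _ _ _ ⟩
    x⁻¹ * (x * y)        ≈⟨ *-cong refl e ⟩
    x⁻¹ * (x * z)        ≈⟨ *-assoc _ _ _ ⟨
    (x⁻¹ * x) * z        ≈⟨ *-cong x⁻¹x≈1 refl ⟩
    1# * z               ≈⟨ *-identityˡ z ⟩
    z                    ∎
    where
    x⁻¹ = inv K x x≉0
    x⁻¹x≈1 : x⁻¹ * x ≈ 1#
    x⁻¹x≈1 = trans (*-comm _ _) (proj₂ (inverse x x≉0))

  -- ln f = Σ (-1)ᵐ gᵐ⁺¹/(m+1) with g = f - 1, so (ln f)' = Σ (-1)ᵐ gᵐ g' and (ln f)' f = f' telescopes.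
  module Logarithm (ch : CharZero K) (f : Series K) (f0≈1 : f 0 ≈ 1#) where
    g : Series K
    g = minusOne K f

    g0≈0 : g 0 ≈ 0#
    g0≈0 = trans (+-cong f0≈1 refl) (-‿inverseʳ 1#)

    f≈1+g : ∀ i → f i ≈ oneS K i + g i
    f≈1+g zero = begin
      f 0               ≈⟨ +-identityˡ _ ⟨
      0# + f 0          ≈⟨ +-cong (-‿inverseʳ 1#) refl ⟨
      (1# + - 1#) + f 0 ≈⟨ +-assoc _ _ _ ⟩
      1# + (- 1# + f 0) ≈⟨ +-cong refl (+-comm _ _) ⟩
      1# + (f 0 - 1#)   ∎
    f≈1+g (suc i) = sym (+-identityˡ _)

    ln : Series K
    ln = lnCoeff K ch f

    sgn : ℕ → Carrier
    sgn = signPow K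

    gᵐ∂g : ℕ → Series K
    gᵐ∂g m = powS K g m ⋆ ∂ g

    ∂ln≈Σ : ∀ k → ∂ ln k ≈ Σ< (λ m → sgn m * gᵐ∂g m k) (suc k)
    ∂ln≈Σ k = trans (sym (Σ<-*ˡ _ _ (suc k))) (Σ<-cong (suc k) term)
      where
      term : ∀ m → ι (suc k) * ((sgn m * recipSuc K ch m) * powS K g (suc m) (suc k)) ≈ sgn m * gᵐ∂g m k
      term m = begin
          ι (suc k) * ((sgn m * r) * powS K g (suc m) (suc k))
        ≈⟨ x∙yz≈y∙xz _ _ _ ⟩
          (sgn m * r) * ∂ (powS K g (suc m)) k
        ≈⟨ *-cong refl (∂-powS g m k) ⟩
          (sgn m * r) * (ι (suc m) * gᵐ∂g m k)
        ≈⟨ trans (*-assoc _ _ _) (*-cong refl (x∙yz≈yx∙z _ _ _)) ⟩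
          sgn m * ((ι (suc m) * r) * gᵐ∂g m k)
        ≈⟨ *-cong refl (trans (*-cong (proj₂ (inverse (ι (suc m)) (ch m))) refl) (*-identityˡ _)) ⟩
          sgn m * gᵐ∂g m k ∎
        where r = recipSuc K ch m

    ∂ln≈Σ-extended : ∀ n k → k N.≤ n → ∂ ln k ≈ Σ< (λ m → sgn m * gᵐ∂g m k) (suc n)
    ∂ln≈Σ-extended n k k≤n = trans (∂ln≈Σ k) (sym (Σ<-extend _ (s≤s k≤n) λ m k<m _ →
      trans (*-cong refl (⋆-vanishes (powS K g m) (∂ g) k (λ i i≤k → powS-vanishes g g0≈0 m i (NP.≤-trans (s≤s i≤k) k<m))))
            (zeroʳ _)))

    gᵐ∂g⋆f : ∀ m n → (gᵐ∂g m ⋆ f) n ≈ gᵐ∂g m n + gᵐ∂g (suc m) n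
    gᵐ∂g⋆f m n = trans (⋆-cong {a = gᵐ∂g m} (λ _ → refl) f≈1+g n) (trans (⋆-distribˡ-+ (gᵐ∂g m) (oneS K) g n)
      (+-cong (trans (⋆-comm (gᵐ∂g m) (oneS K) n) (⋆-identityˡ (gᵐ∂g m) n))
              (trans (⋆-comm (gᵐ∂g m) g n) (sym (⋆-assoc g (powS K g m) (∂ g) n)))))

    telescope : ∀ (b : ℕ → Carrier) M → Σ< (λ m → sgn m * (b m + b (suc m))) M ≈ b 0 + - (sgn M * b M)
    telescope b zero = sym (trans (+-cong refl (-‿cong (*-identityˡ _))) (-‿inverseʳ _))
    telescope b (suc M) = begin
        Σ< (λ m → sgn m * (b m + b (suc m))) M + sgn M * (b M + b (suc M))
      ≈⟨ +-cong (telescope b M) (distribˡ _ _ _) ⟩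
        (b 0 + - (sgn M * b M)) + (sgn M * b M + sgn M * b (suc M))
      ≈⟨ solve 4 (λ a b c d → ((a ⊕ b) ⊕ (c ⊕ d)) ⊜ (a ⊕ ((b ⊕ c) ⊕ d))) refl _ _ _ _ ⟩
        b 0 + ((- (sgn M * b M) + sgn M * b M) + sgn M * b (suc M))
      ≈⟨ +-cong refl (trans (+-cong (-‿inverseˡ _) refl) (+-identityˡ _)) ⟩
        b 0 + sgn M * b (suc M)
      ≈⟨ +-cong refl (trans (-‿cong (sym (-‿distribˡ-* _ _))) (-‿involutive _)) ⟨
        b 0 + - (sgn (suc M) * b (suc M)) ∎

    ∂ln⋆f≈∂f : ∀ n → (∂ ln ⋆ f) n ≈ ∂ f n
    ∂ln⋆f≈∂f n = begin
        (∂ ln ⋆ f) n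
      ≈⟨ ⋆-cong≤ {b = f} n (∂ln≈Σ-extended n) (λ _ _ → refl) ⟩
        ((λ k → Σ< (λ m → sgn m * gᵐ∂g m k) (suc n)) ⋆ f) n
      ≈⟨ ⋆-Σ<ˡ (λ m k → sgn m * gᵐ∂g m k) (suc n) f n ⟩
        Σ< (λ m → ((λ k → sgn m * gᵐ∂g m k) ⋆ f) n) (suc n)
      ≈⟨ Σ<-cong (suc n) (λ m → trans (⋆-comm _ f n) (trans (⋆-*ʳ f (sgn m) (gᵐ∂g m) n)
            (*-cong refl (trans (⋆-comm f (gᵐ∂g m) n) (gᵐ∂g⋆f m n))))) ⟩
        Σ< (λ m → sgn m * (gᵐ∂g m n + gᵐ∂g (suc m) n)) (suc n)
      ≈⟨ telescope (λ m → gᵐ∂g m n) (suc n) ⟩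
        gᵐ∂g 0 n + - (sgn (suc n) * gᵐ∂g (suc n) n)
      ≈⟨ +-cong (⋆-identityˡ (∂ g) n) (trans (-‿cong (trans (*-cong refl
            (⋆-vanishes (powS K g (suc n)) (∂ g) n (λ i i≤n → powS-vanishes g g0≈0 (suc n) i (s≤s i≤n)))) (zeroʳ _)))
            -0#≈0#) ⟩
        ∂ g n + 0#
      ≈⟨ +-identityʳ _ ⟩
        ∂ f n ∎

    ⋆f-injective : ∀ (a b : Series K) → (∀ n → (a ⋆ f) n ≈ (b ⋆ f) n) → ∀ n → a n ≈ b n
    ⋆f-injective a b e = <-rec (λ n → a n ≈ b n) step
      where
      fₙ₋ₙ≈1 : ∀ n → f (n ∸ n) ≈ 1#
      fₙ₋ₙ≈1 n = trans (reflexive (P.cong f (NP.n∸n≡0 n))) f0≈1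
      step : ∀ n → (∀ {i} → i N.< n → a i ≈ b i) → a n ≈ b n
      step n ih = begin
        a n                 ≈⟨ *-identityʳ _ ⟨
        a n * 1#            ≈⟨ *-cong refl (fₙ₋ₙ≈1 n) ⟨
        a n * f (n ∸ n)     ≈⟨ +-cancelˡ _ _ _ (trans (+-cong (Σ<-cong< n (λ i i<n → *-cong (sym
            (ih i<n)) refl)) refl) (e n)) ⟩
        b n * f (n ∸ n)     ≈⟨ *-cong refl (fₙ₋ₙ≈1 n) ⟩
        b n * 1#            ≈⟨ *-identityʳ _ ⟩
        b n                 ∎

    ln-unique : (t : Series K) → (∀ n → (∂ t ⋆ f) n ≈ ∂ f n) → ∀ n → ln (suc n) ≈ t (suc n)
    ln-unique t ∂t⋆f≈∂f n = *-cancelˡ-nonzero _ (ch n) (⋆f-injective (∂ ln) (∂ t) (λ m → trans (∂ln⋆f≈∂f m) (sym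
        (∂t⋆f≈∂f m))) n)

module ListSums {c ℓ} (K : Field c ℓ) where
  open Field K hiding (zero)
  open import Algebra.Properties.CommutativeSemigroup +-commutativeSemigroup using (interchange)
  open import Algebra.Properties.CommutativeSemigroup *-commutativeSemigroup using ()
    renaming (interchange to *-interchange)

  ∑ : ∀ {A : Set} → List A → (A → Carrier) → Carrier
  ∑ xs h = foldr (λ x acc → h x + acc) 0# xs

  ∏ : ∀ {A : Set} → List A → (A → Carrier) → Carrier
  ∏ xs h = foldr (λ x acc → h x * acc) 1# xs

  𝟙 : Bool → Carrier
  𝟙 true  = 1#
  𝟙 false = 0#

  𝟙-∧ : ∀ a b → 𝟙 (a ∧ b) ≈ 𝟙 a * 𝟙 b
  𝟙-∧ true  b = sym (*-identityˡ _)
  𝟙-∧ false b = sym (zeroˡ _)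

  module _ {A : Set} where
    ∑-cong : ∀ (xs : List A) {h h'} → (∀ x → h x ≈ h' x) → ∑ xs h ≈ ∑ xs h'
    ∑-cong []       e = refl
    ∑-cong (x ∷ xs) e = +-cong (e x) (∑-cong xs e)

    ∑-+ : ∀ (xs : List A) h h' → ∑ xs (λ x → h x + h' x) ≈ ∑ xs h + ∑ xs h'
    ∑-+ []       h h' = sym (+-identityˡ 0#)
    ∑-+ (x ∷ xs) h h' = trans (+-cong refl (∑-+ xs h h')) (interchange _ _ _ _)

    ∑-*ˡ : ∀ (xs : List A) a h → ∑ xs (λ x → a * h x) ≈ a * ∑ xs h
    ∑-*ˡ []       a h = sym (zeroʳ a)
    ∑-*ˡ (x ∷ xs) a h = trans (+-cong refl (∑-*ˡ xs a h)) (sym (distribˡ a _ _))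

    ∑-*ʳ : ∀ (xs : List A) a h → ∑ xs (λ x → h x * a) ≈ ∑ xs h * a
    ∑-*ʳ xs a h = trans (∑-cong xs (λ x → *-comm (h x) a)) (trans (∑-*ˡ xs a h) (*-comm a _))

    ∑-zero : ∀ (xs : List A) h → (∀ x → h x ≈ 0#) → ∑ xs h ≈ 0#
    ∑-zero []       h e = refl
    ∑-zero (x ∷ xs) h e = trans (+-cong (e x) (∑-zero xs h e)) (+-identityˡ 0#)

    ∑-++ : ∀ (xs ys : List A) h → ∑ (xs ++ ys) h ≈ ∑ xs h + ∑ ys h
    ∑-++ []       ys h = sym (+-identityˡ _)
    ∑-++ (x ∷ xs) ys h = trans (+-cong refl (∑-++ xs ys h)) (sym (+-assoc _ _ _))

    ∑-filter : ∀ (xs : List A) q h → ∑ (filterᵇ q xs) h ≈ ∑ xs (λ x → 𝟙 (q x) * h x)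
    ∑-filter []       q h = refl
    ∑-filter (x ∷ xs) q h with q x
    ... | true  = +-cong (sym (*-identityˡ _)) (∑-filter xs q h)
    ... | false = trans (∑-filter xs q h) (sym (trans (+-cong (zeroˡ _) refl) (+-identityˡ _)))

    ∑-𝟙-* : ∀ (U : A → Bool) xs a → ∑ xs (λ x → 𝟙 (U x) * a) ≈ fromℕ K (length (filterᵇ U xs)) * a
    ∑-𝟙-* U []       a = sym (zeroˡ a)
    ∑-𝟙-* U (x ∷ xs) a with U x
    ... | true  = trans (+-cong (*-identityˡ a) (∑-𝟙-* U xs a))
                        (trans (+-cong (sym (*-identityˡ a)) refl) (sym (distribʳ a 1# _)))
    ... | false = trans (+-cong (zeroˡ a) (∑-𝟙-* U xs a)) (+-identityˡ _)

    ∏-cong : ∀ (xs : List A) {h h'} → (∀ x → h x ≈ h' x) → ∏ xs h ≈ ∏ xs h'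
    ∏-cong []       e = refl
    ∏-cong (x ∷ xs) e = *-cong (e x) (∏-cong xs e)

    ∏-* : ∀ (xs : List A) h h' → ∏ xs (λ x → h x * h' x) ≈ ∏ xs h * ∏ xs h'
    ∏-* []       h h' = sym (*-identityˡ 1#)
    ∏-* (x ∷ xs) h h' = trans (*-cong refl (∏-* xs h h')) (*-interchange _ _ _ _)

    ∏-one : ∀ (xs : List A) h → (∀ x → h x ≈ 1#) → ∏ xs h ≈ 1#
    ∏-one []       h e = refl
    ∏-one (x ∷ xs) h e = trans (*-cong (e x) (∏-one xs h e)) (*-identityˡ _)

  module _ {A B : Set} where
    ∑-swap : ∀ (xs : List A) (ys : List B) (h : A → B → Carrier) →
             ∑ xs (λ x → ∑ ys (h x)) ≈ ∑ ys (λ y → ∑ xs (λ x → h x y))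
    ∑-swap []       ys h = sym (∑-zero ys _ (λ _ → refl))
    ∑-swap (x ∷ xs) ys h = trans (+-cong refl (∑-swap xs ys h)) (sym (∑-+ ys (h x) (λ y → ∑ xs (λ x → h x y))))

    ∑-map : ∀ (f : A → B) xs h → ∑ (map f xs) h ≈ ∑ xs (λ x → h (f x))
    ∑-map f []       h = refl
    ∑-map f (x ∷ xs) h = +-cong refl (∑-map f xs h)

    ∑-concatMap : ∀ (f : A → List B) xs h → ∑ (concatMap f xs) h ≈ ∑ xs (λ x → ∑ (f x) h)
    ∑-concatMap f []       h = refl
    ∑-concatMap f (x ∷ xs) h = trans (∑-++ (f x) (concatMap f xs) h) (+-cong refl (∑-concatMap f xs h))

  ∑-tabulate : ∀ {A : Set} {k} (g : Fin k → A) h → ∑ (tabulate g) h ≈ ∑ (allFin k) (λ i → h (g i))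
  ∑-tabulate g h = reflexive (foldr-tabulate (λ x acc → h x + acc) 0# g)

  ∏-tabulate : ∀ {A : Set} {k} (g : Fin k → A) h → ∏ (tabulate g) h ≈ ∏ (allFin k) (λ i → h (g i))
  ∏-tabulate g h = reflexive (foldr-tabulate (λ x acc → h x * acc) 1# g)

  ∏-==F : ∀ {k} (r : Fin k) a → ∏ (allFin k) (λ v → if v ==F r then a else 1#) ≈ a
  ∏-==F {suc k} zero a = trans
    (*-cong (reflexive (P.cong (if_then a else 1#) (==F-refl {suc k} zero)))
            (trans (∏-tabulate suc (λ v → if _==F_ {suc k} v zero then a else 1#))
                   (∏-one (allFin k) _ λ v → reflexive (P.cong (if_then a else 1#)
                       (≢⇒==F-false {suc k} {suc v} {zero} λ ())))))
    (*-identityʳ a)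
  ∏-==F {suc k} (suc r) a =
    trans (*-cong (reflexive (P.cong (if_then a else 1#) (≢⇒==F-false {suc k} {zero} {suc r} λ ())))
                  (trans (∏-tabulate suc (λ v → if _==F_ {suc k} v (suc r) then a else 1#)) (∏-==F r a)))
          (*-identityˡ a)

  Enumerates : ∀ {A : Set} → (A → A → Bool) → List A → Set ℓ
  Enumerates eq xs = ∀ a → ∑ xs (λ y → 𝟙 (eq y a)) ≈ 1#

  ∑-select : ∀ {A : Set} {eq : A → A → Bool} {xs} → Enumerates eq xs → ∀ a (h : A → Carrier) b →
             (∀ y → eq y a ≡ true → h y ≈ b) → ∑ xs (λ y → 𝟙 (eq y a) * h y) ≈ b
  ∑-select {eq = eq} {xs} xs-enum a h b h≈b =
    trans (∑-cong xs select) (trans (∑-*ʳ xs b _) (trans (*-cong (xs-enum a) refl) (*-identityˡ _)))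
    where
    select : ∀ y → 𝟙 (eq y a) * h y ≈ 𝟙 (eq y a) * b
    select y with eq y a | h≈b y
    ... | true  | hy≈b = *-cong refl (hy≈b P.refl)
    ... | false | _    = trans (zeroˡ _) (sym (zeroˡ _))

  functions-enumerates : ∀ {A : Set} {eq : A → A → Bool} {as} → Enumerates eq as →
                         ∀ k → Enumerates (pointwiseᵇ eq k) (functions k as)
  functions-enumerates             as-enum zero    q = +-identityʳ 1#
  functions-enumerates {eq = eq} {as} as-enum (suc k) q =
    trans (∑-concatMap (λ a → map (a ∷ᶠ_) (functions k as)) as _)
    (trans (∑-cong as (λ a → trans (∑-map (a ∷ᶠ_) (functions k as) _)
      (trans (∑-cong (functions k as) (λ p → trans (reflexive (P.cong 𝟙 (P.cong (eq a (q zero) ∧_)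
               (all-tabulate (λ v → eq ((a ∷ᶠ p) v) (q v)) suc))))
               (𝟙-∧ (eq a (q zero)) (pointwiseᵇ eq k p (λ i → q (suc i))))))
      (trans (∑-*ˡ (functions k as) _ _)
             (trans (*-cong refl (functions-enumerates {eq = eq} as-enum k (λ i → q (suc i)))) (*-identityʳ _))))))
    (as-enum (q zero)))

  bools : List Bool
  bools = true ∷ false ∷ []

  bools-enumerates : Enumerates eqBool bools
  bools-enumerates true  = trans (+-cong refl (+-identityˡ _)) (+-identityʳ _)
  bools-enumerates false = trans (+-identityˡ _) (+-identityʳ _)

  allFin-enumerates : ∀ k → Enumerates (_==F_ {k}) (allFin k)
  allFin-enumerates (suc k) zero = trans
    (+-cong (reflexive (P.cong 𝟙 (==F-refl {suc k} zero)))
            (trans (∑-tabulate suc (λ y → 𝟙 (_==F_ {suc k} y zero)))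
                   (∑-zero (allFin k) _ (λ v → reflexive (P.cong 𝟙 (≢⇒==F-false {suc k} {suc v} {zero} λ ()))))))
    (+-identityʳ _)
  allFin-enumerates (suc k) (suc a) = trans
    (+-cong (reflexive (P.cong 𝟙 (≢⇒==F-false {suc k} {zero} {suc a} λ ())))
            (trans (∑-tabulate suc (λ y → 𝟙 (_==F_ {suc k} y (suc a)))) (allFin-enumerates k a)))
    (+-identityˡ _)

  maybeFin : ∀ N → List (Maybe (Fin N))
  maybeFin N = nothing ∷ map just (allFin N)

  maybeFin-enumerates : ∀ N → Enumerates eqMaybe (maybeFin N)
  maybeFin-enumerates N nothing  =
    trans (+-cong refl (trans (∑-map just (allFin N) _) (∑-zero (allFin N) _ (λ _ → refl)))) (+-identityʳ _)
  maybeFin-enumerates N (just a) = trans (+-identityˡ _) (trans (∑-map just (allFin N) _) (allFin-enumerates N a))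

module Ancestors {N : ℕ} (p : Parent N) where

  anc-suc : ∀ k v → anc p (suc k) v ≡ (p v >>= anc p k)
  anc-suc zero v with p v
  ... | nothing = P.refl
  ... | just _  = P.refl
  anc-suc (suc k) v rewrite anc-suc k v with p v
  ... | nothing = P.refl
  ... | just _  = P.refl

  anc-+ : ∀ m t v → anc p (m N.+ t) v ≡ (anc p m v >>= anc p t)
  anc-+ zero    t v = P.refl
  anc-+ (suc m) t v rewrite anc-suc (m N.+ t) v | anc-suc m v with p v
  ... | nothing = P.refl
  ... | just w  = anc-+ m t w

  anc-mono : ∀ {k m v} → anc p k v ≡ nothing → k N.≤ m → anc p m v ≡ nothing
  anc-mono {k} {m} {v} e k≤m rewrite P.sym (NP.m+[n∸m]≡n k≤m) | anc-+ k (m ∸ k) v | e = P.refl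

  anc-periodic : ∀ {v a} I d → anc p I v ≡ just a → anc p (I N.+ suc d) v ≡ just a →
                 ∀ m → anc p (I N.+ m N.* suc d) v ≡ just a
  anc-periodic {v} I d eI eJ zero rewrite NP.+-identityʳ I = eI
  anc-periodic {v} I d eI eJ (suc m) rewrite P.sym (NP.+-assoc I (suc d) (m N.* suc d))
                                           | anc-+ (I N.+ suc d) (m N.* suc d) v | eJ =
    P.trans (P.sym (P.trans (anc-+ I (m N.* suc d) v) (P.cong (_>>= anc p (m N.* suc d)) eI)))
            (anc-periodic I d eI eJ m)

  -- A walk of N steps visits N + 1 vertices, so it repeats one and then cycles forever.
  escapes-within-N : ∀ v k → anc p k v ≡ nothing → anc p N v ≡ nothing
  escapes-within-N v k e with anc p N v in ancN
  ... | nothing = P.refl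
  ... | just _  = ⊥-elim (no-repeat (FP.pigeonhole (NP.n<1+n N) walk))
    where
    walk : Fin (suc N) → Fin N
    walk i = fromMaybe v (anc p (toℕ i) v)
    walk-defined : ∀ i → anc p (toℕ i) v ≡ just (walk i)
    walk-defined i with anc p (toℕ i) v in anc-i
    ... | just _  = P.refl
    ... | nothing with P.trans (P.sym (anc-mono anc-i (NP.≤-pred (FP.toℕ<n i)))) ancN
    ... | ()
    no-repeat : ∃₂ (λ i j → i F.< j × walk i ≡ walk j) → ⊥
    no-repeat (i , j , i<j , same) with NP.m≤n⇒∃[o]m+o≡n i<j
    ... | d , I+1+d≡J with anc-mono e (NP.≤-trans (NP.m≤m*n k (suc d)) (NP.m≤n+m (k N.* suc d) (toℕ i)))
    ... | escaped rewrite anc-periodic (toℕ i) d (walk-defined i)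
                            (P.trans (P.cong (λ m → anc p m v) (P.trans (NP.+-suc (toℕ i) d) I+1+d≡J))
                                     (P.trans (walk-defined j) (P.cong just (P.sym same)))) k
                  with escaped
    ... | ()

  climb : ℕ → Fin N → Fin N
  climb zero    v = v
  climb (suc k) v = maybe (climb k) v (p v)

  root : Fin N → Fin N
  root v = climb (suc N) v

  Acyclic : Set
  Acyclic = ∀ v → anc p N v ≡ nothing

  climb-from-root : ∀ {v} → p v ≡ nothing → ∀ j → climb j v ≡ v
  climb-from-root e zero    = P.refl
  climb-from-root e (suc j) rewrite e = P.refl

  climb-stops : ∀ k v → anc p (suc k) v ≡ nothing → p (climb k v) ≡ nothing × (∀ j → climb (k N.+ j) v ≡ climb k v)
  climb-stops zero    v e = e , climb-from-root e
  climb-stops (suc k) v e rewrite anc-suc (suc k) v with p v in pv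
  ... | nothing = pv , λ _ → P.refl
  ... | just w  = climb-stops k w e

  climb-reaches : ∀ k v a → anc p k v ≡ just a → p a ≡ nothing → ∀ j → climb (k N.+ j) v ≡ a
  climb-reaches zero    v a P.refl pa j = climb-from-root pa j
  climb-reaches (suc k) v a e      pa j rewrite anc-suc k v with p v
  ... | just w = climb-reaches k w a e pa j

  root-reached : ∀ k v a → anc p k v ≡ just a → p a ≡ nothing → k N.≤ suc N → root v ≡ a
  root-reached k v a e pa k≤1+N =
    P.trans (P.cong (λ m → climb m v) (P.sym (NP.m+[n∸m]≡n k≤1+N))) (climb-reaches k v a e pa (suc N ∸ k))

  root-of-root : ∀ {v} → p v ≡ nothing → root v ≡ v
  root-of-root e = climb-from-root e (suc N)

  root-is-root : Acyclic → ∀ v → p (root v) ≡ nothing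
  root-is-root acyclic v = P.subst (λ z → p z ≡ nothing)
    (P.sym (P.trans (P.cong (λ m → climb m v) (NP.+-comm 1 N)) (proj₂ (climb-stops N v anc-1+N) 1)))
    (proj₁ (climb-stops N v anc-1+N))
    where anc-1+N = anc-mono (acyclic v) (NP.n≤1+n N)

  root-of-parent : Acyclic → ∀ {v w} → p v ≡ just w → root v ≡ root w
  root-of-parent acyclic {v} {w} e rewrite e =
    P.sym (P.trans (P.cong (λ m → climb m w) (NP.+-comm 1 N))
                   (proj₂ (climb-stops N w (anc-mono (acyclic w) (NP.n≤1+n N))) 1))

  UpClosed : (Fin N → Bool) → Set
  UpClosed C = ∀ v w → C v ≡ true → p v ≡ just w → C w ≡ true

  climb-closed : ∀ {C} → UpClosed C → ∀ k v → C v ≡ true → C (climb k v) ≡ true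
  climb-closed closed zero    v Cv = Cv
  climb-closed closed (suc k) v Cv with p v in pv
  ... | nothing = Cv
  ... | just w  = climb-closed closed k w (closed v w Cv pv)

  anc-closed : ∀ {C} → UpClosed C → ∀ k v a → C v ≡ true → anc p k v ≡ just a → C a ≡ true
  anc-closed closed zero    v a Cv P.refl = Cv
  anc-closed closed (suc k) v a Cv e rewrite anc-suc k v with p v in pv
  ... | just w = anc-closed closed k w a (closed v w Cv pv) e

  ProperDesc : Fin N → Fin N → Set
  ProperDesc a u = Σ ℕ λ k → k N.< N × anc p (suc k) u ≡ just a

  properDesc⇒ : ∀ a u → properDesc p a u ≡ true → ProperDesc a u
  properDesc⇒ a u e with any-applyUpTo⁻ (λ k → isJust≡ (anc p (suc k) u) a) (λ i → i) N e
  ... | k , k<N , ek with anc p (suc k) u in eq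
  ... | just w = k , k<N , P.trans eq (P.cong just (==F⇒≡ ek))

  ⇒properDesc : ∀ a u → ProperDesc a u → properDesc p a u ≡ true
  ⇒properDesc a u (k , k<N , e) =
    any-applyUpTo⁺ _ (λ i → i) N k k<N (P.subst (λ z → isJust≡ z a ≡ true) (P.sym e) (==F-refl a))

-- Subsets of Fin N are boolean predicates. A forest on S is a parent function on all of Fin N
-- whose vertices outside S are isolated roots.
module Splitting {N : ℕ} where
  Subset : Set
  Subset = Fin N → Bool

  size : Subset → ℕ
  size S = length (filterᵇ S (allFin N))

  _⊆ᵇ_ : Subset → Subset → Bool
  U ⊆ᵇ S = all (λ v → not (U v) ∨ S v) (allFin N)

  remove : Subset → Fin N → Subset
  remove U r v = U v ∧ not (v ==F r)

  diff : Subset → Subset → Subset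
  diff S U v = S v ∧ not (U v)

  parentIn : Subset → Maybe (Fin N) → Bool
  parentIn S nothing  = true
  parentIn S (just w) = S w

  parentOk : Subset → Parent N → Fin N → Bool
  parentOk S p v = if S v then parentIn S (p v) else is-nothing (p v)

  isForestOn : Subset → Parent N → Bool
  isForestOn S p = all (parentOk S p) (allFin N) ∧ isForest p

  everything : Subset
  everything _ = true

  size-everything : size everything ≡ N
  size-everything = P.trans (length-filter-true (allFin N)) (length-tabulate (λ i → i))
    where
    length-filter-true : ∀ (xs : List (Fin N)) → length (filterᵇ everything xs) ≡ length xs
    length-filter-true []       = P.refl
    length-filter-true (_ ∷ xs) = P.cong suc (length-filter-true xs)

  size-remove : ∀ U r → U r ≡ true → size U ≡ suc (size (remove U r))
  size-remove U r r∈U = P.trans (length-filter-split U (_==F r) (allFin N))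
    (P.cong (N._+ size (remove U r)) (P.trans (P.cong length (filterᵇ-cong (allFin N) U∧≡r)) (length-filter-==F r)))
    where
    U∧≡r : ∀ v → (U v ∧ (v ==F r)) ≡ (v ==F r)
    U∧≡r v with v F.≟ r
    ... | yes P.refl = P.cong (_∧ true) r∈U
    ... | no _       = BP.∧-zeroʳ (U v)

  size-diff : ∀ S U → (∀ v → U v ≡ true → S v ≡ true) → size S ≡ size U N.+ size (diff S U)
  size-diff S U U⊆S = P.trans (length-filter-split S U (allFin N))
    (P.cong (N._+ size (diff S U)) (P.cong length (filterᵇ-cong (allFin N) S∧U)))
    where
    S∧U : ∀ v → (S v ∧ U v) ≡ U v
    S∧U v with U v in Uv
    ... | true  = P.cong (_∧ true) (U⊆S v Uv)
    ... | false = BP.∧-zeroʳ (S v)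

  size-zero : ∀ S → size S ≡ 0 → ∀ v → S v ≡ false
  size-zero S e v with S v in Sv
  ... | false = P.refl
  ... | true with P.trans (P.sym e) (size-remove S v Sv)
  ... | ()

  size-suc⇒∃ : ∀ S {n} → size S ≡ suc n → Σ (Fin N) λ x → S x ≡ true
  size-suc⇒∃ S = member (allFin N)
    where
    member : ∀ (xs : List (Fin N)) {n} → length (filterᵇ S xs) ≡ suc n → Σ (Fin N) λ x → S x ≡ true
    member (x ∷ xs) e with S x in Sx
    ... | true  = x , Sx
    ... | false = member xs e

  -- A forest on S with a marked vertex x splits into the tree U of x, the root r of U, the forest p1
  -- on U ∖ {r} left when r is deleted, and the forest p2 on S ∖ U; graft reassembles it.
  orRoot : Fin N → Maybe (Fin N) → Maybe (Fin N)
  orRoot r nothing  = just r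
  orRoot r (just w) = just w

  graft : Subset → Fin N → Parent N → Parent N → Parent N
  graft U r p1 p2 v = if U v then (if v ==F r then nothing else orRoot r (p1 v)) else p2 v

  treeOf : Parent N → Fin N → Subset
  treeOf p x v = Ancestors.root p v ==F Ancestors.root p x

  cutTree : Subset → Fin N → Parent N → Parent N
  cutTree U r p v = if remove U r v then (if eqMaybe (p v) (just r) then nothing else p v) else nothing

  restrictRest : Subset → Subset → Parent N → Parent N
  restrictRest S U p v = if diff S U v then p v else nothing

  isSplitting : Subset → Fin N → Subset → Fin N → Parent N → Parent N → Bool
  isSplitting S x U r p1 p2 = ((U x ∧ U ⊆ᵇ S) ∧ U r) ∧ (isForestOn (remove U r) p1 ∧ isForestOn (diff S U) p2)

  record ForestOn (S : Subset) (p : Parent N) : Set where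
    field
      outside : ∀ v → S v ≡ false → p v ≡ nothing
      closed  : ∀ v w → S v ≡ true → p v ≡ just w → S w ≡ true
      acyclic : Ancestors.Acyclic p

  is-nothing⇒ : ∀ {m : Maybe (Fin N)} → is-nothing m ≡ true → m ≡ nothing
  is-nothing⇒ {nothing} _ = P.refl

  ⇒is-nothing : ∀ {m : Maybe (Fin N)} → m ≡ nothing → is-nothing m ≡ true
  ⇒is-nothing P.refl = P.refl

  isForestOn⇒ : ∀ S p → isForestOn S p ≡ true → ForestOn S p
  isForestOn⇒ S p e = record { outside = outside ; closed = closed ; acyclic = λ v → is-nothing⇒ (all⇒ _ (proj₂
      (∧-elim e)) v) }
    where
    sv = all⇒ (parentOk S p) (proj₁ (∧-elim e))
    outside : ∀ v → S v ≡ false → p v ≡ nothing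
    outside v Sv with sv v
    ... | q rewrite Sv = is-nothing⇒ q
    closed : ∀ v w → S v ≡ true → p v ≡ just w → S w ≡ true
    closed v w Sv pv with sv v
    ... | q rewrite Sv | pv = q

  ⇒isForestOn : ∀ S p → ForestOn S p → isForestOn S p ≡ true
  ⇒isForestOn S p vp = ∧-intro (⇒all (parentOk S p) sv) (⇒all _ (λ v → ⇒is-nothing (ForestOn.acyclic vp v)))
    where
    sv : ∀ v → parentOk S p v ≡ true
    sv v with S v in Sv | p v in pv
    ... | true | nothing = P.refl
    ... | true | just w = ForestOn.closed vp v w Sv pv
    ... | false | _ = ⇒is-nothing (P.trans (P.sym pv) (ForestOn.outside vp v Sv))

  remove⁻ : ∀ {U r w} → remove U r w ≡ true → (U w ≡ true) × ¬ (w ≡ r)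
  remove⁻ {U} {r} {w} e with ∧-elim e
  ... | (a , b) = a , λ w≡r → true≢false (==F-refl w) (P.trans (P.cong (w ==F_) w≡r) (not≡true⇒≡false b))

  diff⁻ : ∀ {S U w} → diff S U w ≡ true → (S w ≡ true) × (U w ≡ false)
  diff⁻ e with ∧-elim e
  ... | (a , b) = a , not≡true⇒≡false b

  ⊆ᵇ⇒ : ∀ {U S} → U ⊆ᵇ S ≡ true → ∀ v → U v ≡ true → S v ≡ true
  ⊆ᵇ⇒ {U} {S} e v Uv with all⇒ _ e v
  ... | q rewrite Uv = q

  ⇒⊆ᵇ : ∀ {U S} → (∀ v → U v ≡ true → S v ≡ true) → U ⊆ᵇ S ≡ true
  ⇒⊆ᵇ {U} {S} f = ⇒all _ λ v → g v
    where g : ∀ v → (not (U v) ∨ S v) ≡ true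
          g v with U v in Uv
          ... | false = P.refl
          ... | true = f v Uv

  record Splits (S : Subset) (x : Fin N) (U : Subset) (r : Fin N) (p1 p2 : Parent N) : Set where
    field
      x∈U     : U x ≡ true
      U⊆S     : ∀ v → U v ≡ true → S v ≡ true
      r∈U     : U r ≡ true
      forest₁ : ForestOn (remove U r) p1
      forest₂ : ForestOn (diff S U) p2

  isSplitting⇒ : ∀ {S x U r p1 p2} → isSplitting S x U r p1 p2 ≡ true → Splits S x U r p1 p2
  isSplitting⇒ {S} {x} {U} {r} {p1} {p2} e = record
    { x∈U = proj₁ x∈U∧U⊆S ; U⊆S = ⊆ᵇ⇒ (proj₂ x∈U∧U⊆S) ; r∈U = proj₂ U-part
    ; forest₁ = isForestOn⇒ _ _ (proj₁ both-forests) ; forest₂ = isForestOn⇒ _ _ (proj₂ both-forests) }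
    where
    parts   = ∧-elim {(U x ∧ U ⊆ᵇ S) ∧ U r} {isForestOn (remove U r) p1 ∧ isForestOn (diff S U) p2} e
    U-part  = ∧-elim {U x ∧ U ⊆ᵇ S} {U r} (proj₁ parts)
    x∈U∧U⊆S = ∧-elim {U x} {U ⊆ᵇ S} (proj₁ U-part)
    both-forests = ∧-elim {isForestOn (remove U r) p1} {isForestOn (diff S U) p2} (proj₂ parts)

  ⇒isSplitting : ∀ {S x U r p1 p2} → Splits S x U r p1 p2 → isSplitting S x U r p1 p2 ≡ true
  ⇒isSplitting splits = ∧-intro (∧-intro (∧-intro x∈U (⇒⊆ᵇ U⊆S)) r∈U) (∧-intro (⇒isForestOn _ _ forest₁)
      (⇒isForestOn _ _ forest₂))
    where open Splits splits

  hook≡suc-size : ∀ (p : Parent N) a (D : Subset) → (∀ u → properDesc p a u ≡ D u) → hook p a ≡ suc (size D)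
  hook≡suc-size p a D e = P.cong (λ z → suc (length z)) (filterᵇ-cong (allFin N) e)

  module Graft {S : Subset} {x : Fin N} {U : Subset} {r : Fin N} {p1 p2 : Parent N} (splits : Splits S x U r p1 p2)
               (p : Parent N) (e : ∀ v → p v ≡ graft U r p1 p2 v) where
    open Splits splits

    p≡p₂ : ∀ v → U v ≡ false → p v ≡ p2 v
    p≡p₂ v Uv = P.trans (e v) (P.cong (λ b → if b then _ else p2 v) Uv)

    r-is-root : p r ≡ nothing
    r-is-root rewrite e r | r∈U | ==F-refl r = P.refl

    p≡orRoot-p₁ : ∀ v → U v ≡ true → ¬ (v ≡ r) → p v ≡ orRoot r (p1 v)
    p≡orRoot-p₁ v Uv ne rewrite e v | Uv | ≢⇒==F-false ne = P.refl

    p₁-edge : ∀ {v w} → p1 v ≡ just w → (remove U r v ≡ true) × (remove U r w ≡ true)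
    p₁-edge {v} {w} pv with remove U r v in mv
    ... | true = P.refl , ForestOn.closed forest₁ v w mv pv
    ... | false with P.trans (P.sym pv) (ForestOn.outside forest₁ v mv)
    ... | ()

    p₂-edge : ∀ {v w} → p2 v ≡ just w → (diff S U v ≡ true) × (diff S U w ≡ true)
    p₂-edge {v} {w} pv with diff S U v in dv
    ... | true = P.refl , ForestOn.closed forest₂ v w dv pv
    ... | false with P.trans (P.sym pv) (ForestOn.outside forest₂ v dv)
    ... | ()

    open Ancestors p using (UpClosed; anc-suc; anc-closed; climb-closed; root-reached; escapes-within-N; ProperDesc;
        properDesc⇒; ⇒properDesc)

    remove⁻-at : ∀ w → remove U r w ≡ true → (U w ≡ true) × ¬ (w ≡ r)
    remove⁻-at w = remove⁻ {U} {r} {w}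
    diff⁻-at : ∀ w → diff S U w ≡ true → (S w ≡ true) × (U w ≡ false)
    diff⁻-at w = diff⁻ {S} {U} {w}

    U-closed : UpClosed U
    U-closed v w Uv pv with v F.≟ r
    ... | yes P.refl with P.trans (P.sym pv) r-is-root
    ...   | ()
    U-closed v w Uv pv | no ne with p1 v in q | P.trans (P.sym pv) (p≡orRoot-p₁ v Uv ne)
    ... | nothing | eq = P.subst (λ z → U z ≡ true) (P.sym (just-injective eq)) r∈U
    ... | just w' | P.refl = proj₁ (remove⁻-at w (proj₂ (p₁-edge q)))

    ∁U-closed : UpClosed (λ v → not (U v))
    ∁U-closed v w nUv pv with p₂-edge (P.trans (P.sym (p≡p₂ v (not≡true⇒≡false nUv))) pv)
    ... | (_ , dw) = ≡false⇒not≡true (proj₂ (diff⁻-at w dw))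

    anc-outside : ∀ v → U v ≡ false → ∀ k → anc p k v ≡ anc p2 k v
    anc-outside v Uv zero = P.refl
    anc-outside v Uv (suc k) rewrite anc-outside v Uv k with anc p2 k v in q
    ... | nothing = P.refl
    ... | just b = p≡p₂ b (not≡true⇒≡false (Ancestors.anc-closed p2 ∁U-closed₂ k v b (≡false⇒not≡true Uv) q))
      where ∁U-closed₂ : Ancestors.UpClosed p2 (λ v → not (U v))
            ∁U-closed₂ v w _ pv = ≡false⇒not≡true (proj₂ (diff⁻-at w (proj₂ (p₂-edge pv))))

    reaches-r-within : ∀ k v → U v ≡ true → anc p1 k v ≡ nothing → Σ ℕ λ j → (j N.≤ k) × (anc p j v ≡ just r)
    reaches-r-within zero v Uv ()
    reaches-r-within (suc k) v Uv a1 with v F.≟ r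
    ... | yes P.refl = 0 , z≤n , P.refl
    ... | no ne with p1 v in q
    ... | nothing = 1 , s≤s z≤n , P.trans (anc-suc 0 v) (P.cong (_>>= anc p 0) (P.trans (p≡orRoot-p₁ v Uv ne) (P.cong
        (orRoot r) q)))
    ... | just w with reaches-r-within k w (proj₁ (remove⁻-at w (proj₂ (p₁-edge q)))) (P.trans (P.sym (P.trans
        (Ancestors.anc-suc p1 k v) (P.cong (_>>= anc p1 k) q))) a1)
    ... | j , jk , aj = suc j , s≤s jk , P.trans (anc-suc j v) (P.trans (P.cong (_>>= anc p j) (P.trans
        (p≡orRoot-p₁ v Uv ne) (P.cong (orRoot r) q))) aj)

    reaches-r : ∀ v → U v ≡ true → Σ ℕ λ j → (j N.≤ N) × (anc p j v ≡ just r)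
    reaches-r v Uv = reaches-r-within N v Uv (ForestOn.acyclic forest₁ v)

    acyclic-p : Ancestors.Acyclic p
    acyclic-p v with U v in Uv
    ... | false = P.trans (anc-outside v Uv N) (ForestOn.acyclic forest₂ v)
    ... | true with reaches-r v Uv
    ... | j , _ , aj = escapes-within-N v (suc j) (P.trans (P.cong (_>>= p) aj) r-is-root)

    root-inside : ∀ v → U v ≡ true → Ancestors.root p v ≡ r
    root-inside v Uv with reaches-r v Uv
    ... | j , jN , aj = root-reached j v r aj r-is-root (NP.m≤n⇒m≤1+n jN)

    root-outside : ∀ v → U v ≡ false → U (Ancestors.root p v) ≡ false
    root-outside v Uv = not≡true⇒≡false (climb-closed ∁U-closed (suc N) v (≡false⇒not≡true Uv))

    anc₁⇒anc : ∀ k v a → anc p1 k v ≡ just a → anc p k v ≡ just a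
    anc₁⇒anc zero v a q = q
    anc₁⇒anc (suc k) v a q with anc p1 k v in q1
    ... | just b = P.trans (P.cong (_>>= p) (anc₁⇒anc k v b q1))
                           (P.trans (p≡orRoot-p₁ b (proj₁ b∈U∖r) (proj₂ b∈U∖r)) (P.cong (orRoot r) q))
      where b∈U∖r = remove⁻-at b (proj₁ (p₁-edge q))

    anc⇒anc₁ : ∀ k v a → U v ≡ true → ¬ (a ≡ r) → anc p k v ≡ just a → anc p1 k v ≡ just a
    anc⇒anc₁ zero v a Uv anr q = q
    anc⇒anc₁ (suc k) v a Uv anr q with anc p k v in q0
    ... | just b with b F.≟ r
    ...   | yes P.refl with P.trans (P.sym q) r-is-root
    ...     | ()
    anc⇒anc₁ (suc k) v a Uv anr q | just b | no bnr
      rewrite anc⇒anc₁ k v b Uv bnr q0 with p1 b in q1 | P.trans (P.sym q) (p≡orRoot-p₁ b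
          (anc-closed U-closed k v b Uv q0) bnr)
    ... | nothing | P.refl = ⊥-elim (anr P.refl)
    ... | just a' | P.refl = P.refl

    hook-outside : ∀ a → U a ≡ false → hook p a ≡ hook p2 a
    hook-outside a Ua = hook≡suc-size p a _ λ u → bool-ext
      (λ h → desc⇒desc₂ u (properDesc⇒ a u h))
      (λ h → ⇒properDesc a u (desc₂⇒desc u (Ancestors.properDesc⇒ p2 a u h)))
      where
      desc⇒desc₂ : ∀ u → ProperDesc a u → properDesc p2 a u ≡ true
      desc⇒desc₂ u (k , k< , q) with U u in Uu
      ... | false = Ancestors.⇒properDesc p2 a u (k , k< , P.trans (P.sym (anc-outside u Uu (suc k))) q)
      ... | true = true≢false (anc-closed U-closed (suc k) u a Uu q) Ua
      desc₂⇒desc : ∀ u → Ancestors.ProperDesc p2 a u → ProperDesc a u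
      desc₂⇒desc u (k , k< , q) with U u in Uu
      ... | false = k , k< , P.trans (anc-outside u Uu (suc k)) q
      ... | true with P.trans (P.sym q) (P.trans (Ancestors.anc-suc p2 k u)
                 (P.cong (_>>= anc p2 k) (ForestOn.outside forest₂ u (P.trans (P.cong (λ z → S u ∧ not z) Uu)
                     (BP.∧-zeroʳ (S u))))))
      ... | ()

    hook-inside : ∀ a → U a ≡ true → ¬ (a ≡ r) → hook p a ≡ hook p1 a
    hook-inside a Ua anr = hook≡suc-size p a _ λ u → bool-ext
      (λ h → Ancestors.⇒properDesc p1 a u (desc⇒desc₁ u (properDesc⇒ a u h)))
      (λ h → ⇒properDesc a u (desc₁⇒desc u (Ancestors.properDesc⇒ p1 a u h)))
      where
      desc⇒desc₁ : ∀ u → ProperDesc a u → Ancestors.ProperDesc p1 a u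
      desc⇒desc₁ u (k , k< , q) with U u in Uu
      ... | true = k , k< , anc⇒anc₁ (suc k) u a Uu anr q
      ... | false = true≢false Ua (not≡true⇒≡false (anc-closed ∁U-closed (suc k) u a (≡false⇒not≡true Uu) q))
      desc₁⇒desc : ∀ u → Ancestors.ProperDesc p1 a u → ProperDesc a u
      desc₁⇒desc u (k , k< , q) = k , k< , anc₁⇒anc (suc k) u a q

    hook-root : hook p r ≡ suc (size (remove U r))
    hook-root = hook≡suc-size p r (remove U r) λ u → bool-ext (λ h → desc⇒removed u (properDesc⇒ r u h))
        (λ h → ⇒properDesc r u (removed⇒desc u h))
      where
      desc⇒removed : ∀ u → ProperDesc r u → remove U r u ≡ true
      desc⇒removed u (k , k< , q) with U u in Uu
      ... | false = true≢false r∈U (not≡true⇒≡false (anc-closed ∁U-closed (suc k) u r (≡false⇒not≡true Uu) q))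
      ... | true = ≡false⇒not≡true (≢⇒==F-false {a = u} {r} λ { P.refl → r-not-own-ancestor k q })
        where r-not-own-ancestor : ∀ k → anc p (suc k) r ≡ just r → ⊥
              r-not-own-ancestor k q with P.trans (P.sym q) (P.trans (anc-suc k r) (P.cong (_>>= anc p k) r-is-root))
              ... | ()
      removed⇒desc : ∀ u → remove U r u ≡ true → ProperDesc r u
      removed⇒desc u m with remove⁻-at u m | reaches-r u (proj₁ (remove⁻-at u m))
      ... | (_ , unr) | zero , _ , P.refl = ⊥-elim (unr P.refl)
      ... | (_ , unr) | suc k , kN , q = k , kN , q

    forestOn-S : ForestOn S p
    forestOn-S = record { outside = outside ; closed = closed ; acyclic = acyclic-p }
      where
      outside : ∀ v → S v ≡ false → p v ≡ nothing
      outside v Sv with U v in Uv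
      ... | true = true≢false (U⊆S v Uv) Sv
      ... | false = P.trans (p≡p₂ v Uv) (ForestOn.outside forest₂ v (P.cong (_∧ not (U v)) Sv))
      closed : ∀ v w → S v ≡ true → p v ≡ just w → S w ≡ true
      closed v w Sv pv with U v in Uv
      ... | true = U⊆S w (U-closed v w Uv pv)
      ... | false = proj₁ (diff⁻-at w (proj₂ (p₂-edge (P.trans (P.sym (p≡p₂ v Uv)) pv))))

    root-x : Ancestors.root p x ≡ r
    root-x = root-inside x x∈U

    U≡treeOf : ∀ v → U v ≡ treeOf p x v
    U≡treeOf v with U v in Uv
    ... | true = P.sym (P.trans (P.cong₂ _==F_ (root-inside v Uv) root-x) (==F-refl r))
    ... | false = P.sym (P.trans (P.cong (Ancestors.root p v ==F_) root-x) (≢⇒==F-false λ eq → true≢false r∈U (P.trans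
        (P.cong U (P.sym eq)) (root-outside v Uv))))

    p₁≡cutTree : ∀ v → p1 v ≡ cutTree U r p v
    p₁≡cutTree v with remove U r v in mv
    ... | false = ForestOn.outside forest₁ v mv
    ... | true with remove⁻-at v mv
    ... | (Uv , vnr) rewrite p≡orRoot-p₁ v Uv vnr with p1 v in q
    ... | nothing rewrite ==F-refl r = P.refl
    ... | just w rewrite ≢⇒==F-false (proj₂ (remove⁻-at w (proj₂ (p₁-edge q)))) = P.refl

    p₂≡restrictRest : ∀ v → p2 v ≡ restrictRest S U p v
    p₂≡restrictRest v with diff S U v in dv
    ... | true = P.sym (p≡p₂ v (proj₂ (diff⁻-at v dv)))
    ... | false = ForestOn.outside forest₂ v dv

  anc-⊑ : ∀ (q p : Parent N) → (∀ v w → q v ≡ just w → p v ≡ just w) → ∀ k v a → anc q k v ≡ just a → anc p k v ≡ just a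
  anc-⊑ q p h zero v a e = e
  anc-⊑ q p h (suc k) v a e with anc q k v in e0
  ... | just b rewrite anc-⊑ q p h k v b e0 = h b a e

  Acyclic-⊑ : ∀ (q p : Parent N) → (∀ v w → q v ≡ just w → p v ≡ just w) → Ancestors.Acyclic p → Ancestors.Acyclic q
  Acyclic-⊑ q p h acyclic v with anc q N v in e
  ... | nothing = P.refl
  ... | just a with P.trans (P.sym (anc-⊑ q p h N v a e)) (acyclic v)
  ... | ()

  module Cut (S : Subset) (x : Fin N) (x∈S : S x ≡ true) (p : Parent N) (forest : ForestOn S p) (U : Subset)
             (p1 p2 : Parent N) (U≡treeOf : ∀ v → U v ≡ treeOf p x v)
             (p₁≡cutTree : ∀ v → p1 v ≡ cutTree U (Ancestors.root p x) p v)
             (p₂≡restrictRest : ∀ v → p2 v ≡ restrictRest S U p v) where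
    open Ancestors p using (root; root-of-root; root-of-parent; root-is-root; climb-closed; UpClosed)
    r : Fin N
    r = root x
    acyclic : Ancestors.Acyclic p
    acyclic = ForestOn.acyclic forest

    U⇒root≡r : ∀ {v} → U v ≡ true → root v ≡ r
    U⇒root≡r {v} h = ==F⇒≡ (P.trans (P.sym (U≡treeOf v)) h)

    root≡r⇒U : ∀ {v} → root v ≡ r → U v ≡ true
    root≡r⇒U {v} h = P.trans (U≡treeOf v) (P.trans (P.cong (_==F r) h) (==F-refl r))

    x∈U : U x ≡ true
    x∈U = root≡r⇒U P.refl

    S-closed : UpClosed S
    S-closed = ForestOn.closed forest

    S-r : S r ≡ true
    S-r = climb-closed S-closed (suc N) x x∈S

    U⊆S : ∀ v → U v ≡ true → S v ≡ true
    U⊆S v Uv with S v in Sv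
    ... | true = P.refl
    ... | false = true≢false (P.subst (λ z → S z ≡ true) (P.sym (P.trans (P.sym (root-of-root
        (ForestOn.outside forest v Sv))) (U⇒root≡r Uv))) S-r) Sv

    r∈U : U r ≡ true
    r∈U = root≡r⇒U (root-of-root (root-is-root acyclic x))

    p₁⊑p : ∀ v w → p1 v ≡ just w → p v ≡ just w
    p₁⊑p v w h rewrite p₁≡cutTree v with remove U r v
    ... | true with p v | eqMaybe (p v) (just r)
    ...   | just w' | false = h
    ...   | nothing | false = h
    p₁⊑p v w () | true | _ | true
    p₁⊑p v w () | false

    p₂⊑p : ∀ v w → p2 v ≡ just w → p v ≡ just w
    p₂⊑p v w h rewrite p₂≡restrictRest v with diff S U v
    ... | true = h
    p₂⊑p v w () | false

    forest₁ : ForestOn (remove U r) p1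
    forest₁ = record { outside = outside ; closed = closed ; acyclic = Acyclic-⊑ p1 p p₁⊑p acyclic }
      where
      outside : ∀ v → remove U r v ≡ false → p1 v ≡ nothing
      outside v mv rewrite p₁≡cutTree v | mv = P.refl
      closed : ∀ v w → remove U r v ≡ true → p1 v ≡ just w → remove U r w ≡ true
      closed v w mv h with p₁⊑p v w h | remove⁻ {U} {r} {v} mv
      ... | pv | (Uv , _) with w F.≟ r
      ... | no wnr = ∧-intro (root≡r⇒U (P.trans (P.sym (root-of-parent acyclic pv)) (U⇒root≡r Uv))) P.refl
      ... | yes P.refl with P.trans (P.sym h) (P.trans (p₁≡cutTree v) (P.trans (P.cong (λ b → if b then _ else nothing) mv)
                              (P.cong (λ m → if eqMaybe m (just r) then nothing else m) pv)))
      ... | q rewrite ==F-refl r with q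
      ... | ()

    forest₂ : ForestOn (diff S U) p2
    forest₂ = record { outside = outside ; closed = closed ; acyclic = Acyclic-⊑ p2 p p₂⊑p acyclic }
      where
      outside : ∀ v → diff S U v ≡ false → p2 v ≡ nothing
      outside v dv rewrite p₂≡restrictRest v | dv = P.refl
      closed : ∀ v w → diff S U v ≡ true → p2 v ≡ just w → diff S U w ≡ true
      closed v w dv h with p₂⊑p v w h | diff⁻ {S} {U} {v} dv
      ... | pv | (Sv , Uv) = ∧-intro (ForestOn.closed forest v w Sv pv)
            (≡false⇒not≡true (P.trans (U≡treeOf w) (P.trans (P.cong (_==F r) (P.sym (root-of-parent acyclic pv))) (P.trans
                (P.sym (U≡treeOf v)) Uv))))

    p≡graft : ∀ v → p v ≡ graft U r p1 p2 v
    p≡graft v with U v in Uv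
    ... | false with S v in Sv
    ...   | true rewrite p₂≡restrictRest v | Sv | Uv = P.refl
    ...   | false rewrite p₂≡restrictRest v | Sv = ForestOn.outside forest v Sv
    p≡graft v | true with v F.≟ r
    ... | yes P.refl = root-is-root acyclic x
    ... | no vnr rewrite p₁≡cutTree v | Uv | ≢⇒==F-false vnr with p v in pv
    ...   | nothing = ⊥-elim (vnr (P.trans (P.sym (root-of-root pv)) (U⇒root≡r Uv)))
    ...   | just w with w F.≟ r
    ...     | yes P.refl = P.refl
    ...     | no wnr = P.refl

    splits : Splits S x U r p1 p2
    splits = record { x∈U = x∈U ; U⊆S = U⊆S ; r∈U = r∈U ; forest₁ = forest₁ ; forest₂ = forest₂ }

  cutsTo : Subset → Fin N → Parent N → Subset → Fin N → Parent N → Parent N → Bool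
  cutsTo S x p U r p1 p2 =
    (pointwiseᵇ eqBool N U (treeOf p x) ∧ (r ==F Ancestors.root p x)) ∧
    (pointwiseᵇ eqMaybe N p1 (cutTree U r p) ∧ pointwiseᵇ eqMaybe N p2 (restrictRest S U p))

  -- Cutting a forest at the tree of x and grafting a splitting are mutually inverse.
  splitting-correct : ∀ S x → S x ≡ true → ∀ U r p1 p2 p →
    (isForestOn S p ∧ cutsTo S x p U r p1 p2) ≡ (isSplitting S x U r p1 p2 ∧ pointwiseᵇ eqMaybe N p (graft U r p1 p2))
  splitting-correct S x x∈S U r p1 p2 p = bool-ext cut⇒graft graft⇒cut
    where
    tree-part  = pointwiseᵇ eqBool N U (treeOf p x)
    root-part  = r ==F Ancestors.root p x
    cut₁-part  = pointwiseᵇ eqMaybe N p1 (cutTree U r p)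
    cut₂-part  = pointwiseᵇ eqMaybe N p2 (restrictRest S U p)

    cut⇒graft : (isForestOn S p ∧ cutsTo S x p U r p1 p2) ≡ true →
                (isSplitting S x U r p1 p2 ∧ pointwiseᵇ eqMaybe N p (graft U r p1 p2)) ≡ true
    cut⇒graft h = with-root r (==F⇒≡ {a = r} {Ancestors.root p x} (proj₂ tree∧root))
      (λ v → eqMaybe⇒≡ (pointwiseᵇ⇒ {eq = eqMaybe} {p = p1} {cutTree U r p} (proj₁ cuts) v))
      where
      forest∧cut = ∧-elim {isForestOn S p} {(tree-part ∧ root-part) ∧ (cut₁-part ∧ cut₂-part)} h
      parts      = ∧-elim {tree-part ∧ root-part} {cut₁-part ∧ cut₂-part} (proj₂ forest∧cut)
      tree∧root  = ∧-elim {tree-part} {root-part} (proj₁ parts)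
      cuts       = ∧-elim {cut₁-part} {cut₂-part} (proj₂ parts)
      with-root : ∀ r′ → r′ ≡ Ancestors.root p x → (∀ v → p1 v ≡ cutTree U r′ p v) →
                  (isSplitting S x U r′ p1 p2 ∧ pointwiseᵇ eqMaybe N p (graft U r′ p1 p2)) ≡ true
      with-root _ P.refl p1≡cut = ∧-intro (⇒isSplitting C.splits) (⇒pointwiseᵇ {eq = eqMaybe} eqMaybe-refl C.p≡graft)
        where
        module C = Cut S x x∈S p (isForestOn⇒ S p (proj₁ forest∧cut)) U p1 p2
          (λ v → eqBool⇒≡ (pointwiseᵇ⇒ {eq = eqBool} {p = U} {treeOf p x} (proj₁ tree∧root) v)) p1≡cut
          (λ v → eqMaybe⇒≡ (pointwiseᵇ⇒ {eq = eqMaybe} {p = p2} {restrictRest S U p} (proj₂ cuts) v))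

    graft⇒cut : (isSplitting S x U r p1 p2 ∧ pointwiseᵇ eqMaybe N p (graft U r p1 p2)) ≡ true →
                (isForestOn S p ∧ cutsTo S x p U r p1 p2) ≡ true
    graft⇒cut h = ∧-intro (⇒isForestOn S p G.forestOn-S)
      (∧-intro (∧-intro (⇒pointwiseᵇ {eq = eqBool} eqBool-refl G.U≡treeOf)
                        (P.subst (λ z → (r ==F z) ≡ true) (P.sym G.root-x) (==F-refl r)))
               (∧-intro (⇒pointwiseᵇ {eq = eqMaybe} eqMaybe-refl G.p₁≡cutTree)
                        (⇒pointwiseᵇ {eq = eqMaybe} eqMaybe-refl G.p₂≡restrictRest)))
      where
      splitting∧graft = ∧-elim {isSplitting S x U r p1 p2} {pointwiseᵇ eqMaybe N p (graft U r p1 p2)} h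
      module G = Graft (isSplitting⇒ {S} {x} {U} {r} {p1} {p2} (proj₁ splitting∧graft)) p
        (λ v → eqMaybe⇒≡ (pointwiseᵇ⇒ {eq = eqMaybe} {p = p} {graft U r p1 p2} (proj₂ splitting∧graft) v))

module SubsetSums {c ℓ} (K : Field c ℓ) where
  open Field K hiding (zero)
  open ListSums K
  open PowerSeries K using (ι; ι-+; Σ<-head; Σ<-cong; Σ<-+)
  open Splitting using (size; _⊆ᵇ_; remove; size-remove)
  open import Relation.Binary.Reasoning.Setoid setoid

  binomialSum : ℕ → (ℕ → Carrier) → Carrier
  binomialSum m h = sumBelow K (λ j → ι (m 𝐂 j) * h j) (suc m)

  binomialSum-pascal : ∀ m h → binomialSum (suc m) h ≈ binomialSum m h + binomialSum m (λ j → h (suc j))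
  binomialSum-pascal m h = begin
      binomialSum (suc m) h
    ≈⟨ Σ<-head _ (suc m) ⟩
      h₀ + sumBelow K (λ j → ι (suc m 𝐂 suc j) * h (suc j)) (suc m)
    ≈⟨ +-cong refl (trans (Σ<-cong (suc m) (λ j → trans (*-cong pascal-rule refl) (distribʳ _ _ _))) (Σ<-+ _ _ (suc m))) ⟩
      h₀ + (shifted + (rest + ι (m 𝐂 suc m) * h (suc m)))
    ≈⟨ +-cong refl (+-cong refl (trans (+-cong refl top-vanishes) (+-identityʳ _))) ⟩
      h₀ + (shifted + rest)
    ≈⟨ trans (+-cong refl (+-comm _ _)) (sym (+-assoc _ _ _)) ⟩
      (h₀ + rest) + shifted
    ≈⟨ +-cong (sym (Σ<-head _ m)) refl ⟩
      binomialSum m h + shifted ∎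
    where
    h₀      = ι 1 * h 0
    shifted = binomialSum m (λ j → h (suc j))
    rest    = sumBelow K (λ j → ι (m 𝐂 suc j) * h (suc j)) m
    pascal-rule : ∀ {j} → ι (suc m 𝐂 suc j) ≈ ι (m 𝐂 j) + ι (m 𝐂 suc j)
    pascal-rule {j} = trans (reflexive (P.cong ι (P.sym (nCk+nC[k+1]≡[n+1]C[k+1] m j)))) (ι-+ (m 𝐂 j) (m 𝐂 suc j))
    top-vanishes : ι (m 𝐂 suc m) * h (suc m) ≈ 0#
    top-vanishes = trans (*-cong (reflexive (P.cong ι (k>n⇒nCk≡0 (NP.n<1+n m)))) refl) (zeroˡ _)

  ⊆ᵇ-∷ : ∀ {k} b (U : Fin k → Bool) (S : Fin (suc k) → Bool) →
         ((b ∷ᶠ U) ⊆ᵇ S) ≡ ((not b ∨ S zero) ∧ (U ⊆ᵇ (λ v → S (suc v))))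
  ⊆ᵇ-∷ b U S = P.cong ((not b ∨ S zero) ∧_) (all-tabulate (λ v → not ((b ∷ᶠ U) v) ∨ S v) suc)

  size-∷ : ∀ {k} b (U : Fin k → Bool) → size (b ∷ᶠ U) ≡ (if b then suc (size U) else size U)
  size-∷ true  U = P.cong suc (length-filter-tabulate (true ∷ᶠ U) suc)
  size-∷ false U = length-filter-tabulate (false ∷ᶠ U) suc

  size-head : ∀ {k} (S : Fin (suc k) → Bool) → size S ≡ (if S zero then suc (size (λ v → S (suc v))) else size
      (λ v → S (suc v)))
  size-head S with S zero
  ... | true  = P.cong suc (length-filter-tabulate S suc)
  ... | false = length-filter-tabulate S suc

  ∑-subsets-∷ : ∀ {k} (g : (Fin (suc k) → Bool) → Carrier) →
    ∑ (functions (suc k) bools) g ≈ ∑ (functions k bools) (λ U → g (true ∷ᶠ U)) + ∑ (functions k bools) (λ U → g (false ∷ᶠ U))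
  ∑-subsets-∷ {k} g = trans (∑-concatMap (λ b → map (b ∷ᶠ_) (functions k bools)) bools g)
    (+-cong (∑-map (true ∷ᶠ_) (functions k bools) g) (trans (+-cong (∑-map (false ∷ᶠ_) (functions k bools) g) refl)
        (+-identityʳ _)))

  ∑-subsets : ∀ k (S : Fin k → Bool) (h : ℕ → Carrier) → ∑ (functions k bools) (λ U → 𝟙 (U ⊆ᵇ S) * h
      (size U)) ≈ binomialSum (size S) h
  ∑-subsets zero    S h = trans (+-identityʳ _) (sym (trans (+-identityˡ _) (*-cong (+-identityʳ 1#) refl)))
  ∑-subsets (suc k) S h = trans (∑-subsets-∷ (λ U → 𝟙 (U ⊆ᵇ S) * h (size U))) (by-head (S zero) P.refl)
    where
    S′ = λ v → S (suc v)
    term : ∀ b U → 𝟙 ((b ∷ᶠ U) ⊆ᵇ S) * h (size (b ∷ᶠ U)) ≈ 𝟙 ((not b ∨ S zero) ∧ (U ⊆ᵇ S′)) * h (if b then suc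
        (size U) else size U)
    term b U = *-cong (reflexive (P.cong 𝟙 (⊆ᵇ-∷ b U S))) (reflexive (P.cong h (size-∷ b U)))
    without-head : ∑ (functions k bools) (λ U → 𝟙 ((false ∷ᶠ U) ⊆ᵇ S) * h (size (false ∷ᶠ U))) ≈ binomialSum (size S′) h
    without-head = trans (∑-cong (functions k bools) (term false)) (∑-subsets k S′ h)
    by-head : ∀ b → S zero ≡ b →
      ∑ (functions k bools) (λ U → 𝟙 ((true ∷ᶠ U) ⊆ᵇ S) * h (size (true ∷ᶠ U))) +
      ∑ (functions k bools) (λ U → 𝟙 ((false ∷ᶠ U) ⊆ᵇ S) * h (size (false ∷ᶠ U))) ≈ binomialSum (size S) h
    by-head true e = begin
        ∑ (functions k bools) (λ U → 𝟙 ((true ∷ᶠ U) ⊆ᵇ S) * h (size (true ∷ᶠ U))) +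
        ∑ (functions k bools) (λ U → 𝟙 ((false ∷ᶠ U) ⊆ᵇ S) * h (size (false ∷ᶠ U)))
      ≈⟨ +-cong (trans (∑-cong (functions k bools) λ U → trans (term true U) (reflexive (P.cong (λ b → 𝟙 (b ∧
          (U ⊆ᵇ S′)) * h (suc (size U))) e)))
                       (∑-subsets k S′ (λ j → h (suc j))))
                without-head ⟩
        binomialSum (size S′) (λ j → h (suc j)) + binomialSum (size S′) h
      ≈⟨ trans (+-comm _ _) (sym (binomialSum-pascal _ h)) ⟩
        binomialSum (suc (size S′)) h
      ≈⟨ reflexive (P.cong (λ m → binomialSum m h) (P.sym (P.trans (size-head S) (P.cong (λ b → if b then suc
          (size S′) else size S′) e)))) ⟩
        binomialSum (size S) h ∎
    by-head false e = trans
      (+-cong (∑-zero (functions k bools) _ λ U → trans (term true U)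
                 (trans (*-cong (reflexive (P.cong (λ b → 𝟙 (b ∧ (U ⊆ᵇ S′))) e)) refl) (zeroˡ _)))
              without-head)
      (trans (+-identityˡ _) (reflexive (P.cong (λ m → binomialSum m h) (P.sym (P.trans (size-head S) (P.cong
          (λ b → if b then suc (size S′) else size S′) e))))))

  ∑-subsets-containing : ∀ k (S : Fin k → Bool) x → S x ≡ true → ∀ (h : ℕ → Carrier) →
    ∑ (functions k bools) (λ U → 𝟙 (U x ∧ (U ⊆ᵇ S)) * h (size U)) ≈ binomialSum (N.pred (size S)) (λ j → h (suc j))
  ∑-subsets-containing (suc k) S x x∈S h = trans (∑-subsets-∷ (λ U → 𝟙 (U x ∧ (U ⊆ᵇ S)) * h (size U))) (by-head x x∈S
      (S zero) P.refl)
    where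
    S′ = λ v → S (suc v)
    part : Fin (suc k) → Bool → Carrier
    part x b = ∑ (functions k bools) (λ U → 𝟙 ((b ∷ᶠ U) x ∧ ((b ∷ᶠ U) ⊆ᵇ S)) * h (size (b ∷ᶠ U)))
    term : ∀ x b U → 𝟙 ((b ∷ᶠ U) x ∧ ((b ∷ᶠ U) ⊆ᵇ S)) * h (size (b ∷ᶠ U)) ≈
                     𝟙 ((b ∷ᶠ U) x ∧ ((not b ∨ S zero) ∧ (U ⊆ᵇ S′))) * h (if b then suc (size U) else size U)
    term x b U = *-cong (reflexive (P.cong (λ z → 𝟙 ((b ∷ᶠ U) x ∧ z)) (⊆ᵇ-∷ b U S))) (reflexive (P.cong h (size-∷ b U)))
    size-S : ∀ {b} → S zero ≡ b → size S ≡ (if b then suc (size S′) else size S′)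
    size-S e = P.trans (size-head S) (P.cong (λ b → if b then suc (size S′) else size S′) e)
    by-head : ∀ x → S x ≡ true → ∀ b → S zero ≡ b → part x true + part x false ≈ binomialSum (N.pred (size S))
        (λ j → h (suc j))
    by-head zero x∈S true e = begin
        part zero true + part zero false
      ≈⟨ +-cong (trans (∑-cong (functions k bools) λ U → trans (term zero true U) (reflexive (P.cong (λ b → 𝟙 (b ∧
          (U ⊆ᵇ S′)) * h (suc (size U))) e)))
                       (∑-subsets k S′ (λ j → h (suc j))))
                (∑-zero (functions k bools) _ (λ _ → zeroˡ _)) ⟩
        binomialSum (size S′) (λ j → h (suc j)) + 0#
      ≈⟨ trans (+-identityʳ _) (reflexive (P.cong (λ m → binomialSum (N.pred m) (λ j → h (suc j))) (P.sym (size-S e)))) ⟩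
        binomialSum (N.pred (size S)) (λ j → h (suc j)) ∎
    by-head zero    x∈S false e = true≢false x∈S e
    by-head (suc x) x∈S true  e = begin
        part (suc x) true + part (suc x) false
      ≈⟨ +-cong (trans (∑-cong (functions k bools) λ U → trans (term (suc x) true U) (reflexive (P.cong (λ b → 𝟙
          (U x ∧ (b ∧ (U ⊆ᵇ S′))) * h (suc (size U))) e)))
                       (∑-subsets-containing k S′ x x∈S (λ j → h (suc j))))
                (trans (∑-cong (functions k bools) (term (suc x) false)) (∑-subsets-containing k S′ x x∈S h)) ⟩
        binomialSum (N.pred (size S′)) (λ j → h (suc (suc j))) + binomialSum (N.pred (size S′)) (λ j → h (suc j))
      ≈⟨ trans (+-comm _ _) (pascal-at (size-remove S′ x x∈S)) ⟩
        binomialSum (size S′) (λ j → h (suc j))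
      ≈⟨ reflexive (P.cong (λ m → binomialSum (N.pred m) (λ j → h (suc j))) (P.sym (size-S e))) ⟩
        binomialSum (N.pred (size S)) (λ j → h (suc j)) ∎
      where
      pascal-at : ∀ {m n} → m ≡ suc n →
        binomialSum (N.pred m) (λ j → h (suc j)) + binomialSum (N.pred m) (λ j → h (suc (suc j))) ≈ binomialSum m
            (λ j → h (suc j))
      pascal-at P.refl = sym (binomialSum-pascal _ (λ j → h (suc j)))
    by-head (suc x) x∈S false e = trans
      (+-cong (∑-zero (functions k bools) _ λ U → trans (term (suc x) true U)
                 (trans (*-cong (reflexive (P.trans (P.cong (λ b → 𝟙 (U x ∧ (b ∧ (U ⊆ᵇ S′)))) e) (P.cong 𝟙 (BP.∧-zeroʳ
                     (U x))))) refl) (zeroˡ _)))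
              (trans (∑-cong (functions k bools) (term (suc x) false)) (∑-subsets-containing k S′ x x∈S h)))
      (trans (+-identityˡ _) (reflexive (P.cong (λ m → binomialSum (N.pred m) (λ j → h (suc j))) (P.sym (size-S e)))))

module ForestSums {c ℓ} (K : Field c ℓ) (ρ : (m : ℕ) → .{{NonZero m}} → Field.Carrier K) where
  open Field K hiding (zero)
  open ListSums K
  open import Relation.Binary.Reasoning.Setoid setoid
  open import Algebra.Solver.CommutativeMonoid *-commutativeMonoid using (solve; _⊜_; _⊕_)
  open PowerSeries K using (ι)

  ρ' : ℕ → Carrier
  ρ' m = ρ (suc m)

  module OnVertices (N : ℕ) where
    open Splitting {N}

    parents : List (Parent N)
    parents = functions N (maybeFin N)

    subsets : List Subset
    subsets = functions N bools

    parents-enumerate : Enumerates (pointwiseᵇ eqMaybe N) parents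
    parents-enumerate = functions-enumerates {eq = eqMaybe} (maybeFin-enumerates N) N

    subsets-enumerate : Enumerates (pointwiseᵇ eqBool N) subsets
    subsets-enumerate = functions-enumerates {eq = eqBool} bools-enumerates N

    vertexWeight : Subset → Parent N → Fin N → Carrier
    vertexWeight S p v = if S v then ρ (hook p v) else 1#

    weight : Subset → Parent N → Carrier
    weight S p = ∏ (allFin N) (vertexWeight S p)

    forestSumOn : Subset → Carrier
    forestSumOn S = ∑ parents (λ p → 𝟙 (isForestOn S p) * weight S p)

    vertexWeight-in : ∀ S p v → S v ≡ true → vertexWeight S p v ≡ ρ' (length (filterᵇ (properDesc p v) (allFin N)))
    vertexWeight-in S p v e rewrite e = P.refl

    vertexWeight-out : ∀ S p v → S v ≡ false → vertexWeight S p v ≡ 1#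
    vertexWeight-out S p v e rewrite e = P.refl

    -- In the graft, r has hook |U| and every other vertex keeps its hook from p1 or p2.
    weight-graft : ∀ {S x U r p1 p2} → Splits S x U r p1 p2 → ∀ p → (∀ v → p v ≡ graft U r p1 p2 v) →
                   weight S p ≈ weight (remove U r) p1 * (weight (diff S U) p2 * ρ' (size (remove U r)))
    weight-graft {S} {x} {U} {r} {p1} {p2} splits p p≡graft = begin
        ∏ (allFin N) (vertexWeight S p)
      ≈⟨ ∏-cong (allFin N) factor ⟩
        ∏ (allFin N) (λ v → vertexWeight (remove U r) p1 v * (vertexWeight (diff S U) p2 v * atRoot v))
      ≈⟨ trans (∏-* (allFin N) _ _) (*-cong refl (∏-* (allFin N) _ _)) ⟩
        weight (remove U r) p1 * (weight (diff S U) p2 * ∏ (allFin N) atRoot)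
      ≈⟨ *-cong refl (*-cong refl (∏-==F r ρ-r)) ⟩
        weight (remove U r) p1 * (weight (diff S U) p2 * ρ-r) ∎
      where
      open Splits splits
      module G = Graft splits p p≡graft
      ρ-r = ρ' (size (remove U r))
      atRoot : Fin N → Carrier
      atRoot v = if v ==F r then ρ-r else 1#
      descendants : Parent N → Fin N → ℕ
      descendants q v = length (filterᵇ (properDesc q v) (allFin N))
      Factors : Fin N → Set ℓ
      Factors v = vertexWeight S p v ≈ vertexWeight (remove U r) p1 v * (vertexWeight (diff S U) p2 v * atRoot v)
      root-factor : Factors r
      root-factor = begin
          vertexWeight S p r
        ≈⟨ reflexive (P.trans (vertexWeight-in S p r (U⊆S r r∈U)) (P.cong ρ' (NP.suc-injective G.hook-root))) ⟩
          ρ-r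
        ≈⟨ trans (*-identityˡ _) (*-identityˡ _) ⟨
          1# * (1# * ρ-r)
        ≈⟨ *-cong (reflexive (vertexWeight-out (remove U r) p1 r (P.cong₂ (λ a b → a ∧ not b) r∈U (==F-refl r))))
                  (*-cong (reflexive (vertexWeight-out (diff S U) p2 r (P.cong₂ (λ a b → a ∧ not b) (U⊆S r r∈U) r∈U)))
                          (reflexive (P.cong (if_then ρ-r else 1#) (==F-refl r)))) ⟨
          vertexWeight (remove U r) p1 r * (vertexWeight (diff S U) p2 r * atRoot r) ∎
      tree-factor : ∀ v → U v ≡ true → ¬ (v ≡ r) → Factors v
      tree-factor v Uv v≢r = begin
          vertexWeight S p v
        ≈⟨ reflexive (P.trans (vertexWeight-in S p v (U⊆S v Uv)) (P.cong ρ' (NP.suc-injective (G.hook-inside v Uv v≢r)))) ⟩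
          ρ' (descendants p1 v)
        ≈⟨ trans (*-cong refl (*-identityˡ _)) (*-identityʳ _) ⟨
          ρ' (descendants p1 v) * (1# * 1#)
        ≈⟨ *-cong (reflexive (vertexWeight-in (remove U r) p1 v (∧-intro Uv (≡false⇒not≡true (≢⇒==F-false v≢r)))))
                  (*-cong (reflexive (vertexWeight-out (diff S U) p2 v (P.cong₂ (λ a b → a ∧ not b) (U⊆S v Uv) Uv)))
                          (reflexive (P.cong (if_then ρ-r else 1#) (≢⇒==F-false v≢r)))) ⟨
          vertexWeight (remove U r) p1 v * (vertexWeight (diff S U) p2 v * atRoot v) ∎
      rest-factor : ∀ v → U v ≡ false → S v ≡ true → Factors v
      rest-factor v Uv Sv = begin
          vertexWeight S p v
        ≈⟨ reflexive (P.trans (vertexWeight-in S p v Sv) (P.cong ρ' (NP.suc-injective (G.hook-outside v Uv)))) ⟩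
          ρ' (descendants p2 v)
        ≈⟨ trans (*-identityˡ _) (*-identityʳ _) ⟨
          1# * (ρ' (descendants p2 v) * 1#)
        ≈⟨ *-cong (reflexive (vertexWeight-out (remove U r) p1 v (P.cong (λ a → a ∧ not (v ==F r)) Uv)))
                  (*-cong (reflexive (vertexWeight-in (diff S U) p2 v (P.cong₂ (λ a b → a ∧ not b) Sv Uv)))
                          (reflexive (P.cong (if_then ρ-r else 1#)
                              (≢⇒==F-false {a = v} {r} λ { P.refl → true≢false r∈U Uv })))) ⟨
          vertexWeight (remove U r) p1 v * (vertexWeight (diff S U) p2 v * atRoot v) ∎
      outside-factor : ∀ v → U v ≡ false → S v ≡ false → Factors v
      outside-factor v Uv Sv = begin
          vertexWeight S p v
        ≈⟨ reflexive (vertexWeight-out S p v Sv) ⟩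
          1#
        ≈⟨ trans (*-identityˡ _) (*-identityˡ _) ⟨
          1# * (1# * 1#)
        ≈⟨ *-cong (reflexive (vertexWeight-out (remove U r) p1 v (P.cong (λ a → a ∧ not (v ==F r)) Uv)))
                  (*-cong (reflexive (vertexWeight-out (diff S U) p2 v (P.cong₂ (λ a b → a ∧ not b) Sv Uv)))
                          (reflexive (P.cong (if_then ρ-r else 1#)
                              (≢⇒==F-false {a = v} {r} λ { P.refl → true≢false r∈U Uv })))) ⟨
          vertexWeight (remove U r) p1 v * (vertexWeight (diff S U) p2 v * atRoot v) ∎
      factor : ∀ v → Factors v
      factor v = by-root (v F.≟ r)
        where
        by-membership : ¬ v ≡ r → ∀ u → U v ≡ u → ∀ s → S v ≡ s → Factors v
        by-membership v≢r true  Uv _     _  = tree-factor v Uv v≢r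
        by-membership v≢r false Uv true  Sv = rest-factor v Uv Sv
        by-membership v≢r false Uv false Sv = outside-factor v Uv Sv
        by-root : Dec (v ≡ r) → Factors v
        by-root (yes P.refl) = root-factor
        by-root (no v≢r)     = by-membership v≢r (U v) P.refl (S v) P.refl

    -- Every forest cuts at x into exactly one splitting, so we may insert the sum of the indicators of
    -- its cuts, exchange the order of summation, and use splitting-correct to sum out the forest.
    module Decompose (S : Subset) (x : Fin N) (x∈S : S x ≡ true) where
      forestTerm : Parent N → Carrier
      forestTerm p = 𝟙 (isForestOn S p) * weight S p

      cutIndicator : Parent N → Subset → Fin N → Parent N → Parent N → Carrier
      cutIndicator p U r p1 p2 = 𝟙 (pointwiseᵇ eqBool N U (treeOf p x)) * (𝟙 (r ==F Ancestors.root p x) *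
                                 (𝟙 (pointwiseᵇ eqMaybe N p1 (cutTree U r p)) * 𝟙 (pointwiseᵇ eqMaybe N p2
                                     (restrictRest S U p))))

      ∑-splittings : (Subset → Fin N → Parent N → Parent N → Carrier) → Carrier
      ∑-splittings g = ∑ subsets (λ U → ∑ (allFin N) (λ r → ∑ parents (λ p1 → ∑ parents (λ p2 → g U r p1 p2))))

      ∑-cutIndicator : ∀ p → ∑-splittings (cutIndicator p) ≈ 1#
      ∑-cutIndicator p = trans (∑-cong subsets (λ U → trans (∑-cong (allFin N) (λ r → trans (∑-cong parents (λ p1 →
          trans (∑-*ˡ parents _ _) (*-cong refl (trans (∑-*ˡ parents _ _) (*-cong refl (trans (∑-*ˡ parents _ _)
            (trans (*-cong refl (parents-enumerate (restrictRest S U p))) (*-identityʳ _))))))))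
          (trans (∑-*ˡ parents _ _) (*-cong refl (trans (∑-*ˡ parents _ _) (trans (*-cong refl (parents-enumerate
              (cutTree U r p))) (*-identityʳ _)))))))
          (trans (∑-*ˡ (allFin N) _ _) (trans (*-cong refl (allFin-enumerates N (Ancestors.root p x))) (*-identityʳ _)))))
        (subsets-enumerate (treeOf p x))

      forestSumOn≈∑-splittings : forestSumOn S ≈ ∑-splittings (λ U r p1 p2 → ∑ parents
          (λ p → forestTerm p * cutIndicator p U r p1 p2))
      forestSumOn≈∑-splittings = begin
          forestSumOn S
        ≈⟨ ∑-cong parents (λ p → sym (trans (*-cong refl (∑-cutIndicator p)) (*-identityʳ _))) ⟩
          ∑ parents (λ p → forestTerm p * ∑-splittings (cutIndicator p))
        ≈⟨ ∑-cong parents (λ p → trans (sym (∑-*ˡ subsets (forestTerm p) _)) (∑-cong subsets (λ U → trans (sym (∑-*ˡ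
            (allFin N) (forestTerm p) _))
              (∑-cong (allFin N) (λ r → trans (sym (∑-*ˡ parents (forestTerm p) _)) (∑-cong parents (λ p1 → sym
                  (∑-*ˡ parents (forestTerm p) _)))))))) ⟩
          ∑ parents (λ p → ∑-splittings (λ U r p1 p2 → forestTerm p * cutIndicator p U r p1 p2))
        ≈⟨ ∑-swap parents subsets _ ⟩
          ∑ subsets (λ U → ∑ parents (λ p → ∑ (allFin N) (λ r → ∑ parents (λ p1 → ∑ parents
              (λ p2 → forestTerm p * cutIndicator p U r p1 p2)))))
        ≈⟨ ∑-cong subsets (λ U → trans (∑-swap parents (allFin N) _) (∑-cong (allFin N) (λ r → trans
            (∑-swap parents parents _)
              (∑-cong parents (λ p1 → ∑-swap parents parents _))))) ⟩
          ∑-splittings (λ U r p1 p2 → ∑ parents (λ p → forestTerm p * cutIndicator p U r p1 p2)) ∎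

      graftWeight : Subset → Fin N → Parent N → Parent N → Carrier
      graftWeight U r p1 p2 = weight (remove U r) p1 * (weight (diff S U) p2 * ρ' (size (remove U r)))

      ∑-graft : ∀ U r p1 p2 → ∑ parents (λ p → forestTerm p * cutIndicator p U r p1 p2) ≈ (𝟙
          (isSplitting S x U r p1 p2) * graftWeight U r p1 p2)
      ∑-graft U r p1 p2 = begin
          ∑ parents (λ p → forestTerm p * cutIndicator p U r p1 p2)
        ≈⟨ ∑-cong parents rearrange ⟩
          ∑ parents (λ p → 𝟙 (isSplitting S x U r p1 p2) * (𝟙 (pointwiseᵇ eqMaybe N p (graft U r p1 p2)) * weight S p))
        ≈⟨ ∑-*ˡ parents _ _ ⟩
          𝟙 (isSplitting S x U r p1 p2) * ∑ parents (λ p → 𝟙 (pointwiseᵇ eqMaybe N p (graft U r p1 p2)) * weight S p)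
        ≈⟨ select-graft (isSplitting S x U r p1 p2) P.refl ⟩
          𝟙 (isSplitting S x U r p1 p2) * graftWeight U r p1 p2 ∎
        where
        rearrange : ∀ p → forestTerm p * cutIndicator p U r p1 p2 ≈
                    𝟙 (isSplitting S x U r p1 p2) * (𝟙 (pointwiseᵇ eqMaybe N p (graft U r p1 p2)) * weight S p)
        rearrange p = begin
            (𝟙 forest * weight S p) * (𝟙 tree * (𝟙 root * (𝟙 cut₁ * 𝟙 cut₂)))
          ≈⟨ solve 6 (λ a b c d e w → ((a ⊕ w) ⊕ (b ⊕ (c ⊕ (d ⊕ e)))) ⊜ ((a ⊕ ((b ⊕ c) ⊕ (d ⊕ e))) ⊕ w)) refl
                     (𝟙 forest) (𝟙 tree) (𝟙 root) (𝟙 cut₁) (𝟙 cut₂) (weight S p) ⟩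
            (𝟙 forest * ((𝟙 tree * 𝟙 root) * (𝟙 cut₁ * 𝟙 cut₂))) * weight S p
          ≈⟨ *-cong (sym (trans (𝟙-∧ forest _) (*-cong refl (trans (𝟙-∧ (tree ∧ root) (cut₁ ∧ cut₂))
                                                                    (*-cong (𝟙-∧ tree root) (𝟙-∧ cut₁ cut₂)))))) refl ⟩
            𝟙 (isForestOn S p ∧ cutsTo S x p U r p1 p2) * weight S p
          ≈⟨ *-cong (reflexive (P.cong 𝟙 (splitting-correct S x x∈S U r p1 p2 p))) refl ⟩
            𝟙 (isSplitting S x U r p1 p2 ∧ pointwiseᵇ eqMaybe N p (graft U r p1 p2)) * weight S p
          ≈⟨ trans (*-cong (𝟙-∧ (isSplitting S x U r p1 p2) (pointwiseᵇ eqMaybe N p (graft U r p1 p2))) refl)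
              (*-assoc _ _ _) ⟩
            𝟙 (isSplitting S x U r p1 p2) * (𝟙 (pointwiseᵇ eqMaybe N p (graft U r p1 p2)) * weight S p) ∎
          where
          forest = isForestOn S p
          tree   = pointwiseᵇ eqBool N U (treeOf p x)
          root   = r ==F Ancestors.root p x
          cut₁   = pointwiseᵇ eqMaybe N p1 (cutTree U r p)
          cut₂   = pointwiseᵇ eqMaybe N p2 (restrictRest S U p)
        select-graft : ∀ b → isSplitting S x U r p1 p2 ≡ b → (𝟙 b * ∑ parents (λ p → 𝟙 (pointwiseᵇ eqMaybe N p
            (graft U r p1 p2)) * weight S p)) ≈ (𝟙 b * graftWeight U r p1 p2)
        select-graft false _ = trans (zeroˡ _) (sym (zeroˡ _))
        select-graft true h = *-cong refl (∑-select {eq = pointwiseᵇ eqMaybe N} {parents} parents-enumerate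
            (graft U r p1 p2) (weight S) _ λ y ey →
            weight-graft (isSplitting⇒ {S} {x} {U} {r} {p1} {p2} h) y (λ v → eqMaybe⇒≡
                (pointwiseᵇ⇒ {eq = eqMaybe} {p = y} {graft U r p1 p2} ey v)))

      graftTerm-factor : ∀ U r p1 p2 → 𝟙 (isSplitting S x U r p1 p2) * graftWeight U r p1 p2 ≈
        𝟙 (U x ∧ U ⊆ᵇ S) * (𝟙 (U r) * (ρ' (size (remove U r)) *
          ((𝟙 (isForestOn (remove U r) p1) * weight (remove U r) p1) * (𝟙 (isForestOn (diff S U) p2) * weight
              (diff S U) p2))))
      graftTerm-factor U r p1 p2 = begin
          𝟙 (((U x ∧ U ⊆ᵇ S) ∧ U r) ∧ (forest₁ ∧ forest₂)) * (w₁ * (w₂ * ρ-r))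
        ≈⟨ *-cong (trans (𝟙-∧ ((U x ∧ U ⊆ᵇ S) ∧ U r) (forest₁ ∧ forest₂)) (*-cong (𝟙-∧ (U x ∧ U ⊆ᵇ S) (U r))
            (𝟙-∧ forest₁ forest₂))) refl ⟩
          ((𝟙 (U x ∧ U ⊆ᵇ S) * 𝟙 (U r)) * (𝟙 forest₁ * 𝟙 forest₂)) * (w₁ * (w₂ * ρ-r))
        ≈⟨ solve 7 (λ a b c d e f g → (((a ⊕ b) ⊕ (c ⊕ d)) ⊕ (e ⊕ (f ⊕ g))) ⊜ (a ⊕ (b ⊕ (g ⊕ ((c ⊕ e) ⊕ (d ⊕ f)))))) refl
                   (𝟙 (U x ∧ U ⊆ᵇ S)) (𝟙 (U r)) (𝟙 forest₁) (𝟙 forest₂) w₁ w₂ ρ-r ⟩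
          𝟙 (U x ∧ U ⊆ᵇ S) * (𝟙 (U r) * (ρ-r * ((𝟙 forest₁ * w₁) * (𝟙 forest₂ * w₂)))) ∎
        where
        forest₁ = isForestOn (remove U r) p1
        forest₂ = isForestOn (diff S U) p2
        w₁      = weight (remove U r) p1
        w₂      = weight (diff S U) p2
        ρ-r     = ρ' (size (remove U r))

      ∑-forests-below : ∀ U r → ∑ parents (λ p1 → ∑ parents (λ p2 → ∑ parents
          (λ p → forestTerm p * cutIndicator p U r p1 p2)))
                      ≈ (𝟙 (U x ∧ U ⊆ᵇ S) * (𝟙 (U r) * (ρ' (size (remove U r)) * (forestSumOn
                          (remove U r) * forestSumOn (diff S U)))))
      ∑-forests-below U r = trans (∑-cong parents ∑-forests₂) (trans (∑-*ˡ parents _ _) (*-cong refl (trans (∑-*ˡ parents _ _)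
                    (*-cong refl (trans (∑-*ˡ parents _ _) (*-cong refl (∑-*ʳ parents _ _)))))))
        where
        ∑-forests₂ : ∀ p1 → ∑ parents (λ p2 → ∑ parents (λ p → forestTerm p * cutIndicator p U r p1 p2)) ≈
                   (𝟙 (U x ∧ U ⊆ᵇ S) * (𝟙 (U r) * (ρ' (size (remove U r)) * ((𝟙 (isForestOn (remove U r) p1) * weight
                       (remove U r) p1) * forestSumOn (diff S U)))))
        ∑-forests₂ p1 = trans (∑-cong parents (λ p2 → trans (∑-graft U r p1 p2) (graftTerm-factor U r p1 p2)))
                      (trans (∑-*ˡ parents _ _) (*-cong refl (trans (∑-*ˡ parents _ _) (*-cong refl (trans
                          (∑-*ˡ parents _ _) (*-cong refl (∑-*ˡ parents _ _)))))))

      forestSumOn-decompose : forestSumOn S ≈ ∑ subsets (λ U → 𝟙 (U x ∧ U ⊆ᵇ S) *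
        ∑ (allFin N) (λ r → 𝟙 (U r) * (ρ' (size (remove U r)) * (forestSumOn (remove U r) * forestSumOn (diff S U)))))
      forestSumOn-decompose = trans forestSumOn≈∑-splittings
        (∑-cong subsets (λ U → trans (∑-cong (allFin N) (∑-forests-below U)) (∑-*ˡ (allFin N) _ _)))

    forestSumOn-everything : forestSumOn everything ≈ forestSum K ρ N
    forestSumOn-everything = trans
      (∑-cong parents (λ p → *-cong (reflexive (P.cong (λ b → 𝟙 (b ∧ isForest p)) (⇒all (parentOk everything p)
          (parentOk-everything p))))
                                   refl))
      (sym (∑-filter parents isForest (weight everything)))
      where
      parentOk-everything : ∀ p v → parentOk everything p v ≡ true
      parentOk-everything p v with p v
      ... | nothing = P.refl
      ... | just _  = P.refl

    forestSumOn-empty : ∀ S → (∀ v → S v ≡ false) → forestSumOn S ≈ 1#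
    forestSumOn-empty S S≡∅ = begin
        ∑ parents (λ p → 𝟙 (isForestOn S p) * weight S p)
      ≈⟨ ∑-cong parents (λ p → *-cong (reflexive (P.cong 𝟙 (bool-ext (forest⇒isolated p) (isolated⇒forest p))))
                                      (∏-one (allFin N) _ (λ v → reflexive (vertexWeight-out S p v (S≡∅ v))))) ⟩
        ∑ parents (λ p → 𝟙 (pointwiseᵇ eqMaybe N p (λ _ → nothing)) * 1#)
      ≈⟨ trans (∑-cong parents (λ p → *-identityʳ _)) (parents-enumerate (λ _ → nothing)) ⟩
        1# ∎
      where
      forest⇒isolated : ∀ p → isForestOn S p ≡ true → pointwiseᵇ eqMaybe N p (λ _ → nothing) ≡ true
      forest⇒isolated p h = ⇒pointwiseᵇ {eq = eqMaybe} eqMaybe-refl (λ v → ForestOn.outside (isForestOn⇒ S p h) v (S≡∅ v))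
      isolated⇒forest : ∀ p → pointwiseᵇ eqMaybe N p (λ _ → nothing) ≡ true → isForestOn S p ≡ true
      isolated⇒forest p h = ⇒isForestOn S p (record
        { outside = λ v _ → isolated v
        ; closed  = λ v _ Sv _ → true≢false Sv (S≡∅ v)
        ; acyclic = λ v → Ancestors.escapes-within-N p v 1 (isolated v) })
        where
        isolated : ∀ v → p v ≡ nothing
        isolated v = eqMaybe⇒≡ (pointwiseᵇ⇒ {eq = eqMaybe} {p = p} {λ _ → nothing} h v)

  open SubsetSums K

  forestSumK : ℕ → Carrier
  forestSumK m = forestSum K ρ m

  forestRecurrence : ℕ → Carrier
  forestRecurrence n = binomialSum n (λ j → ι (suc j) * (ρ' j * (forestSumK j * forestSumK (n ∸ j))))

  SizeInvariant : ℕ → Set ℓ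
  SizeInvariant m = ∀ N (S : Fin N → Bool) → Splitting.size S ≡ m → OnVertices.forestSumOn N S ≈ forestSumK m

  forestSumOn-recurrence : ∀ n → (∀ {j} → j N.< suc n → SizeInvariant j) →
                           ∀ N (S : Fin N → Bool) → Splitting.size S ≡ suc n → OnVertices.forestSumOn N S ≈ forestRecurrence n
  forestSumOn-recurrence n smaller-invariant N S |S|≡1+n = begin
      forestSumOn S
    ≈⟨ Decompose.forestSumOn-decompose S x x∈S ⟩
      ∑ subsets (λ U → 𝟙 (U x ∧ U ⊆ᵇ S) * ∑ (allFin N) (λ r → 𝟙 (U r) * rootedTerm U r))
    ≈⟨ ∑-cong subsets (λ U → per-subset U (U x ∧ U ⊆ᵇ S) P.refl) ⟩
      ∑ subsets (λ U → 𝟙 (U x ∧ U ⊆ᵇ S) * subsetTerm (size U))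
    ≈⟨ ∑-subsets-containing N S x x∈S subsetTerm ⟩
      binomialSum (N.pred (size S)) (λ j → subsetTerm (suc j))
    ≈⟨ reflexive (P.cong (λ m → binomialSum (N.pred m) (λ j → subsetTerm (suc j))) |S|≡1+n) ⟩
      forestRecurrence n ∎
    where
    open OnVertices N
    open Splitting {N}
    x   = proj₁ (size-suc⇒∃ S |S|≡1+n)
    x∈S = proj₂ (size-suc⇒∃ S |S|≡1+n)
    rootedTerm : Subset → Fin N → Carrier
    rootedTerm U r = ρ' (size (remove U r)) * (forestSumOn (remove U r) * forestSumOn (diff S U))
    treeTerm : ℕ → Carrier
    treeTerm j = ρ' (N.pred j) * (forestSumK (N.pred j) * forestSumK (suc n ∸ j))
    subsetTerm : ℕ → Carrier
    subsetTerm j = ι j * treeTerm j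
    per-subset : ∀ U b → (U x ∧ U ⊆ᵇ S) ≡ b →
                 𝟙 b * ∑ (allFin N) (λ r → 𝟙 (U r) * rootedTerm U r) ≈ 𝟙 b * subsetTerm (size U)
    per-subset U false _ = trans (zeroˡ _) (sym (zeroˡ _))
    per-subset U true x∈U⊆S = *-cong refl
      (trans (∑-cong (allFin N) (λ r → per-root r (U r) P.refl)) (∑-𝟙-* U (allFin N) (treeTerm (size U))))
      where
      x∈U∧U⊆S = ∧-elim {U x} {U ⊆ᵇ S} x∈U⊆S
      |S|≡|U|+|S∖U| : suc n ≡ size U N.+ size (diff S U)
      |S|≡|U|+|S∖U| = P.trans (P.sym |S|≡1+n) (size-diff S U (⊆ᵇ⇒ (proj₂ x∈U∧U⊆S)))
      per-root : ∀ r b → U r ≡ b → 𝟙 b * rootedTerm U r ≈ 𝟙 b * treeTerm (size U)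
      per-root r false _   = trans (zeroˡ _) (sym (zeroˡ _))
      per-root r true  r∈U = *-cong refl (begin
          ρ' (size (remove U r)) * (forestSumOn (remove U r) * forestSumOn (diff S U))
        ≈⟨ *-cong refl (*-cong (smaller-invariant smaller₁ N (remove U r) P.refl)
                               (smaller-invariant smaller₂ N (diff S U) P.refl)) ⟩
          ρ' (size (remove U r)) * (forestSumK (size (remove U r)) * forestSumK (size (diff S U)))
        ≈⟨ reflexive (P.cong₂ (λ a b → ρ' a * (forestSumK a * forestSumK b))
                              (P.cong N.pred (P.sym |U|≡1+|U∖r|))
                              (P.sym (P.trans (P.cong (_∸ size U) |S|≡|U|+|S∖U|) (NP.m+n∸m≡n (size U) _)))) ⟩
          treeTerm (size U) ∎)
        where
        |U|≡1+|U∖r| = size-remove U r r∈U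
        smaller₁ : size (remove U r) N.< suc n
        smaller₁ = P.subst (suc (size (remove U r)) N.≤_) (P.sym |S|≡|U|+|S∖U|)
                           (P.subst (N._≤ size U N.+ size (diff S U)) |U|≡1+|U∖r| (NP.m≤m+n (size U) _))
        smaller₂ : size (diff S U) N.< suc n
        smaller₂ = P.subst (suc (size (diff S U)) N.≤_) (P.sym |S|≡|U|+|S∖U|)
                           (P.subst (λ z → suc (size (diff S U)) N.≤ z N.+ size (diff S U))
                                    (P.sym (size-remove U x (proj₁ x∈U∧U⊆S))) (s≤s (NP.m≤n+m _ _)))

  forestSumOn-size : ∀ m → SizeInvariant m
  forestSumOn-size = <-rec SizeInvariant invariant
    where
    invariant : ∀ m → (∀ {j} → j N.< m → SizeInvariant j) → SizeInvariant m
    invariant zero    _  N S |S|≡0 =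
      trans (OnVertices.forestSumOn-empty N S (Splitting.size-zero S |S|≡0)) (sym (+-identityʳ 1#))
    invariant (suc n) ih N S |S|≡1+n = trans (forestSumOn-recurrence n ih N S |S|≡1+n) (sym (begin
      forestSumK (suc n)                         ≈⟨ OnVertices.forestSumOn-everything (suc n) ⟨
      OnVertices.forestSumOn (suc n) everything  ≈⟨ forestSumOn-recurrence n ih (suc n) everything size-everything ⟩
      forestRecurrence n                         ∎))
      where open Splitting {suc n} using (everything; size-everything)

  forestSum-recurrence : ∀ n → forestSumK (suc n) ≈ forestRecurrence n
  forestSum-recurrence n = begin
    forestSumK (suc n)                         ≈⟨ OnVertices.forestSumOn-everything (suc n) ⟨
    OnVertices.forestSumOn (suc n) everything  ≈⟨ forestSumOn-recurrence n (λ _ → forestSumOn-size _)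
        (suc n) everything size-everything ⟩
    forestRecurrence n                         ∎
    where open Splitting {suc n} using (everything; size-everything)

nCk*[k!*[n∸k]!]≡n! : ∀ {n k} → k N.≤ n → (n 𝐂 k) N.* (k ! N.* (n ∸ k) !) ≡ n !
nCk*[k!*[n∸k]!]≡n! {n} {k} k≤n =
  P.trans (P.cong (N._* (k ! N.* (n ∸ k) !)) (nCk≡n!/k![n-k]! k≤n))
          (m/n*n≡m ⦃ m*n≢0 (k !) ((n ∸ k) !) ⦃ k !≢0 ⦄ ⦃ (n ∸ k) !≢0 ⦄ ⦄ (k![n∸k]!∣n! k≤n))

module LogarithmOfForestSeries {c ℓ} (K : Field c ℓ) (ch : CharZero K)
  (ρ : (m : ℕ) → .{{NonZero m}} → Field.Carrier K) (f : Series K)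
  (f0≈1 : Field._≈_ K (f 0) (Field.1# K))
  (f≈forestSum/n! : (n : ℕ) → Field._≈_ K (f (suc n))
                                         (Field._*_ K (forestSum K ρ (suc n)) (recip K ch (suc n !) {{suc n !≢0}}))) where
  open Field K hiding (zero)
  open import Relation.Binary.Reasoning.Setoid setoid
  open import Algebra.Solver.CommutativeMonoid *-commutativeMonoid using (solve; _⊜_; _⊕_)
  open PowerSeries K
  open PowerSeries.Logarithm K ch f f0≈1 using (ln; ln-unique)
  open ForestSums K ρ using (forestSumK; forestRecurrence; forestSum-recurrence)

  ι≉0 : ∀ n → .{{NonZero n}} → ¬ (ι n ≈ 0#)
  ι≉0 (suc n) = ch n

  ι*recip≈1 : ∀ n .{{_ : NonZero n}} → ι n * recip K ch n ≈ 1#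
  ι*recip≈1 (suc n) = proj₂ (inverse (ι (suc n)) (ch n))

  forestSum≈n!*f : ∀ n → forestSumK n ≈ ι (n !) * f n
  forestSum≈n!*f zero    = trans (+-identityʳ 1#) (sym (trans (*-cong (+-identityʳ 1#) f0≈1) (*-identityˡ 1#)))
  forestSum≈n!*f (suc n) = sym (begin
      ι (suc n !) * f (suc n)
    ≈⟨ *-cong refl (f≈forestSum/n! n) ⟩
      ι (suc n !) * (forestSumK (suc n) * recip K ch (suc n !) {{suc n !≢0}})
    ≈⟨ x∙yz≈y∙xz _ _ _ ⟩
      forestSumK (suc n) * (ι (suc n !) * recip K ch (suc n !) {{suc n !≢0}})
    ≈⟨ *-cong refl (ι*recip≈1 (suc n !) {{suc n !≢0}}) ⟩
      forestSumK (suc n) * 1#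
    ≈⟨ *-identityʳ _ ⟩
      forestSumK (suc n) ∎)
    where open import Algebra.Properties.CommutativeSemigroup *-commutativeSemigroup using (x∙yz≈y∙xz)

  t : Series K
  t zero    = 0#
  t (suc n) = ρ (suc n) * f n

  n!*recurrence-term : ∀ m j → j N.≤ m →
    ι (m 𝐂 j) * (ι (suc j) * (ρ (suc j) * (forestSumK j * forestSumK (m ∸ j)))) ≈ ι (m !) * (∂ t j * f (m ∸ j))
  n!*recurrence-term m j j≤m = begin
      ι (m 𝐂 j) * (ι (suc j) * (ρ (suc j) * (forestSumK j * forestSumK (m ∸ j))))
    ≈⟨ *-cong refl (*-cong refl (*-cong refl (*-cong (forestSum≈n!*f j) (forestSum≈n!*f (m ∸ j))))) ⟩
      ι (m 𝐂 j) * (ι (suc j) * (ρ (suc j) * ((ι (j !) * f j) * (ι ((m ∸ j) !) * f (m ∸ j)))))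
    ≈⟨ solve 7 (λ c s r a fj b fk → (c ⊕ (s ⊕ (r ⊕ ((a ⊕ fj) ⊕ (b ⊕ fk))))) ⊜ ((c ⊕ (a ⊕ b)) ⊕ ((s ⊕ (r ⊕ fj)) ⊕ fk))) refl
               (ι (m 𝐂 j)) (ι (suc j)) (ρ (suc j)) (ι (j !)) (f j) (ι ((m ∸ j) !)) (f (m ∸ j)) ⟩
      (ι (m 𝐂 j) * (ι (j !) * ι ((m ∸ j) !))) * ((ι (suc j) * (ρ (suc j) * f j)) * f (m ∸ j))
    ≈⟨ *-cong (trans (*-cong refl (sym (ι-* (j !) ((m ∸ j) !))))
                     (trans (sym (ι-* (m 𝐂 j) _)) (reflexive (P.cong ι (nCk*[k!*[n∸k]!]≡n! j≤m))))) refl ⟩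
      ι (m !) * (∂ t j * f (m ∸ j)) ∎

  ∂t⋆f≈∂f : ∀ m → (∂ t ⋆ f) m ≈ ∂ f m
  ∂t⋆f≈∂f m = *-cancelˡ-nonzero (ι (m !)) (ι≉0 (m !) {{m !≢0}}) (begin
      ι (m !) * (∂ t ⋆ f) m
    ≈⟨ Σ<-*ˡ _ _ (suc m) ⟨
      Σ< (λ j → ι (m !) * (∂ t j * f (m ∸ j))) (suc m)
    ≈⟨ Σ<-cong< (suc m) (λ j j<1+m → sym (n!*recurrence-term m j (N.s≤s⁻¹ j<1+m))) ⟩
      forestRecurrence m
    ≈⟨ forestSum-recurrence m ⟨
      forestSumK (suc m)
    ≈⟨ forestSum≈n!*f (suc m) ⟩
      ι (suc m !) * f (suc m)
    ≈⟨ *-cong (ι-* (suc m) (m !)) refl ⟩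
      (ι (suc m) * ι (m !)) * f (suc m)
    ≈⟨ trans (*-cong (*-comm _ _) refl) (*-assoc _ _ _) ⟩
      ι (m !) * ∂ f m ∎)

  ln≈ρf : ∀ n → ln (suc n) ≈ ρ (suc n) * f n
  ln≈ρf = ln-unique t ∂t⋆f≈∂f

theorem4p4 : ∀ {c ℓ} (K : Field c ℓ) (ch : CharZero K)
  (ρ : (m : ℕ) → .{{NonZero m}} → Field.Carrier K)
  (f : Series K) →
  let open Field K in
  f 0 ≈ 1# →
  ((n : ℕ) → f (suc n) ≈ (forestSum K ρ (suc n) * recip K ch (suc n !) {{suc n !≢0}})) →
  (n : ℕ) → (nz : ¬ (f n ≈ 0#)) →
  ρ (suc n) ≈ (lnCoeff K ch f (suc n) * inv K (f n) nz)
theorem4p4 K ch ρ f f0≈1 f≈forestSum/n! n fₙ≉0 = begin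
    ρ (suc n)                                ≈⟨ *-identityʳ _ ⟨
    ρ (suc n) * 1#                           ≈⟨ *-cong refl (proj₂ (inverse (f n) fₙ≉0)) ⟨
    ρ (suc n) * (f n * fₙ⁻¹)                 ≈⟨ *-assoc _ _ _ ⟨
    (ρ (suc n) * f n) * fₙ⁻¹                 ≈⟨ *-cong (ln≈ρf n) refl ⟨
    lnCoeff K ch f (suc n) * fₙ⁻¹            ∎
  where
  open Field K
  open import Relation.Binary.Reasoning.Setoid setoid
  open LogarithmOfForestSeries K ch ρ f f0≈1 f≈forestSum/n! using (ln≈ρf)
  fₙ⁻¹ = inv K (f n) fₙ≉0
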